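{- Let $\mathcal{N}^0$ be a simple acyclic oriented matroid of rank $2$ on the ground set $E_m=\{1,\dots,m\}$, with set of topes $\mathcal{T}^0$. Let $(j_1,\dots,j_s)$ be a nonempty sequence of integers with $j_i\in E_m$ for $1\le i\le s$, and define recursively the reorientations $\mathcal{N}^i:={}_{ -j_i}\mathcal{N}^{i-1}$, $1\le i\le s$. Then $\mathcal{N}^s$ has a critical tope committee.
   Context: An oriented matroid on a finite set $E$ is given by its set of covectors $\mathcal{L}\subseteq\{ -,0,+\}^E$; its topes are the covectors of inclusion-maximal support. For a sign vector $X$, $X^+:=\{e: X(e)=+\}$. For $A\subseteq E$, ${}_{ -A}X$ is obtained from $X$ by reversing the signs of the components in $A$ (write ${}_{ -e}X$ for ${}_{ -\{e\}}X$); the reorientation ${}_{ -A}\mathcal{M}$ has covector set $\{{}_{ -A}X: X\in\mathcal{L}\}$. Simple means: no loops (elements $e$ with $T(e)=0$ for all topes $T$), no parallel elements ($X(e)=X(f)$ for all covectors), no antiparallel elements ($X(e)=-X(f)$ for all covectors). Acyclic means $(+\cdots+)$ is a tope. A tope committee is a subset $\mathcal{K}^{\ast}$ of the tope set $\mathcal{T}$ such that $|\{K\in\mathcal{K}^{\ast}:K(e)=+\}|>\tfrac12|\mathcal{K}^{\ast}|$ for every $e\in E$. It is minimal if no proper subset is a tope committee. A minimal tope committee $\mathcal{K}^{\ast}$ is critical if whenever $K\in\mathcal{K}^{\ast}$, $T\in\mathcal{T}$ and $T^+\subsetneqq K^+$, the set $(\mathcal{K}^{\ast}-\{K\})\cup\{T\}$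 is not a tope committee. -}

module Defs where

open import Data.Nat using (ℕ; _*_; _<_)
open import Data.Fin using (Fin)
open import Data.Vec using (Vec; lookup; replicate; tabulate)
open import Data.Bool using (Bool; true)
open import Data.List using (List; []; _∷_; length; filter; foldl)
open import Data.List.Membership.Propositional using (_∈_; _∉_)
open import Data.List.Relation.Unary.All using (All)
open import Data.List.Relation.Unary.Unique.Propositional using (Unique)
open import Data.Product using (Σ; ∃; _×_; _,_)
open import Data.Sum using (_⊎_)
open import Relation.Nullary using (¬_; Dec; yes; no)
open import Relation.Binary.PropositionalEquality using (_≡_; _≢_; refl)

data Sign : Set where
  neg zer pos : Sign

_≟ₛ_ : (a b : Sign) → Dec (a ≡ b)
neg ≟ₛ neg = yes refl
neg ≟ₛ zer = no (λ ())
neg ≟ₛ pos = no (λ ())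
zer ≟ₛ neg = no (λ ())
zer ≟ₛ zer = yes refl
zer ≟ₛ pos = no (λ ())
pos ≟ₛ neg = no (λ ())
pos ≟ₛ zer = no (λ ())
pos ≟ₛ pos = yes refl

opp : Sign → Sign
opp neg = pos
opp zer = zer
opp pos = neg

SignVec : ℕ → Set
SignVec m = Vec Sign m

negate : ∀ {m} → SignVec m → SignVec m
negate X = tabulate (λ i → opp (lookup X i))

compose : ∀ {m} → SignVec m → SignVec m → SignVec m
compose X Y = tabulate (λ i → comp (lookup X i) (lookup Y i))
  where
  comp : Sign → Sign → Sign
  comp zer b = b
  comp a   b = a

Separates : ∀ {m} → SignVec m → SignVec m → Fin m → Set
Separates X Y e = (lookup X e ≡ opp (lookup Y e)) × (lookup X e ≢ zer)

SignSet : ℕ → Set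
SignSet m = SignVec m → Bool

_∈L_ : ∀ {m} → SignVec m → SignSet m → Set
X ∈L L = L X ≡ true

record IsOM {m : ℕ} (L : SignSet m) : Set where
  field
    L0 : replicate m zer ∈L L
    L1 : ∀ X → X ∈L L → negate X ∈L L
    L2 : ∀ X Y → X ∈L L → Y ∈L L → compose X Y ∈L L
    L3 : ∀ X Y → X ∈L L → Y ∈L L → ∀ e → Separates X Y e →
         Σ (SignVec m) λ Z → Z ∈L L × lookup Z e ≡ zer ×
           (∀ f → ¬ Separates X Y f → lookup Z f ≡ lookup (compose X Y) f)

SuppSub : ∀ {m} → SignVec m → SignVec m → Set
SuppSub X Y = ∀ i → lookup X i ≢ zer → lookup Y i ≢ zer

IsTope : ∀ {m} → SignSet m → SignVec m → Set
IsTope L T = T ∈L L × (∀ Y → Y ∈L L → SuppSub T Y → SuppSub Y T)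

-- Rank 2 via the conformal order on covectors:
-- X ≤ Y iff X(e) ∈ {0, Y(e)} for all e.  The rank of the oriented matroid
-- is the length of a longest chain 0 = X₀ < X₁ < ... < X_r of covectors.

Conf≤ : ∀ {m} → SignVec m → SignVec m → Set
Conf≤ X Y = ∀ i → (lookup X i ≡ zer) ⊎ (lookup X i ≡ lookup Y i)

Conf< : ∀ {m} → SignVec m → SignVec m → Set
Conf< X Y = Conf≤ X Y × X ≢ Y

HasRank2 : ∀ {m} → SignSet m → Set
HasRank2 {m} L =
  (Σ (SignVec m) λ X₁ → Σ (SignVec m) λ X₂ →
     X₁ ∈L L × X₂ ∈L L × Conf< (replicate m zer) X₁ × Conf< X₁ X₂)
  × ¬ (Σ (SignVec m) λ X₁ → Σ (SignVec m) λ X₂ → Σ (SignVec m) λ X₃ →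
     X₁ ∈L L × X₂ ∈L L × X₃ ∈L L ×
     Conf< (replicate m zer) X₁ × Conf< X₁ X₂ × Conf< X₂ X₃)

NoLoops : ∀ {m} → SignSet m → Set
NoLoops {m} L = ∀ (e : Fin m) → Σ (SignVec m) λ T → IsTope L T × lookup T e ≢ zer

NoParallel : ∀ {m} → SignSet m → Set
NoParallel {m} L = ∀ (e f : Fin m) → e ≢ f →
  ¬ (∀ X → X ∈L L → lookup X e ≡ lookup X f)

NoAntiparallel : ∀ {m} → SignSet m → Set
NoAntiparallel {m} L = ∀ (e f : Fin m) → e ≢ f →
  ¬ (∀ X → X ∈L L → lookup X e ≡ opp (lookup X f))

IsSimple : ∀ {m} → SignSet m → Set
IsSimple L = NoLoops L × NoParallel L × NoAntiparallel L

IsAcyclic : ∀ {m} → SignSet m → Set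
IsAcyclic {m} L = IsTope L (replicate m pos)

flipAt : ∀ {m} → Fin m → SignVec m → SignVec m
flipAt {m} j X = tabulate f
  where
  f : Fin m → Sign
  f i with Data.Fin._≟_ i j
  ... | yes _ = opp (lookup X i)
  ... | no  _ = lookup X i

-- covectors of _{-j}M are { _{-j}X : X ∈ L }; since flipping is an
-- involution, Y is a covector of _{-j}M iff _{-j}Y ∈ L.
reorient : ∀ {m} → Fin m → SignSet m → SignSet m
reorient j L Y = L (flipAt j Y)

reorientSeq : ∀ {m} → List (Fin m) → SignSet m → SignSet m
reorientSeq js L = foldl (λ L' j → reorient j L') L js

-- Tope committees.  A finite set of topes is represented by a
-- duplicate-free list.

countPos : ∀ {m} → Fin m → List (SignVec m) → ℕ
countPos e Ks = length (filter (λ K → lookup K e ≟ₛ pos) Ks)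

IsTopeCommittee : ∀ {m} → SignSet m → List (SignVec m) → Set
IsTopeCommittee {m} L Ks =
  Unique Ks × All (IsTope L) Ks ×
  (∀ (e : Fin m) → length Ks < 2 * countPos e Ks)

ProperSubset : ∀ {m} → List (SignVec m) → List (SignVec m) → Set
ProperSubset S Ks = All (_∈ Ks) S × Σ _ λ K → K ∈ Ks × K ∉ S

IsMinimalTopeCommittee : ∀ {m} → SignSet m → List (SignVec m) → Set
IsMinimalTopeCommittee L Ks =
  IsTopeCommittee L Ks ×
  (∀ S → Unique S → ProperSubset S Ks → ¬ IsTopeCommittee L S)

PlusProperSub : ∀ {m} → SignVec m → SignVec m → Set
PlusProperSub T K =
  (∀ i → lookup T i ≡ pos → lookup K i ≡ pos) ×
  Σ _ λ i → lookup K i ≡ pos × lookup T i ≢ pos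

ListsSwap : ∀ {m} → List (SignVec m) → SignVec m → SignVec m → List (SignVec m) → Set
ListsSwap Ks K T S =
  ∀ X → (X ∈ S → ((X ∈ Ks × X ≢ K) ⊎ X ≡ T)) × (((X ∈ Ks × X ≢ K) ⊎ X ≡ T) → X ∈ S)

IsCriticalTopeCommittee : ∀ {m} → SignSet m → List (SignVec m) → Set
IsCriticalTopeCommittee L Ks =
  IsMinimalTopeCommittee L Ks ×
  (∀ K T → K ∈ Ks → IsTope L T → PlusProperSub T K →
     ∀ S → Unique S → ListsSwap Ks K T S → ¬ IsTopeCommittee L S)

HasCriticalTopeCommittee : ∀ {m} → SignSet m → Set
HasCriticalTopeCommittee {m} L = Σ (List (SignVec m)) (IsCriticalTopeCommittee L)

{-# OPTIONS --safe #-}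
module Submission where

-- Reorientation preserves what the argument needs from N⁰: the covector axioms, rank 2 in the
-- form "a covector vanishing at two distinct elements is zero", and simplicity in the form
-- "all four sign patterns on two distinct elements occur in topes".  In such an oriented
-- matroid every tope T has exactly two walls, i.e. elements f for which T with T(f) replaced
-- by 0 is a covector, and changing the sign T(f) of a wall gives a tope again.  Call T a peak
-- if it is positive on both of its walls and a valley if negative on both.  Fix e and count,
-- over the topes T with T(e) = +, positive minus negative walls: crossing a wall f ≠ e pairs
-- positive f-walls with negative ones, and exactly two of these topes have e as a wall, both
-- positively, so the count is 2.  Since every tope has two walls, this says that there is
-- one more peak than valley among them, and negation maps these valleys onto the peaks with
-- T(e) = −.  So the peaks form a tope committee.  A tope committee of least total weight
-- ∑ (1 + |K⁺|) is then critical, as dropping a tope, or replacing K by a tope T with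
-- T⁺ ⊊ K⁺, lowers the weight.

open import Defs
open import Data.Bool using (Bool; true; false; if_then_else_)
import Data.Bool.Properties as Bool
open import Data.Empty using (⊥-elim)
open import Data.Unit using (tt)
open import Data.Fin using (Fin; zero; suc) renaming (_≟_ to _≟ᶠ_)
import Data.Fin.Properties as Fin
open import Data.List using (List; []; _∷_; [_]; length; filter; map; _++_)
open import Data.List.Membership.Propositional using (_∈_; _∉_)
open import Data.List.Membership.Propositional.Properties
  using (∈-filter⁻; ∈-filter⁺; ∈-map⁺; ∈-map⁻; ∈-++⁺ˡ; ∈-++⁺ʳ; ∈-++⁻)
open import Data.List.Relation.Unary.All using (All; []; _∷_)
import Data.List.Relation.Unary.All as All
open import Data.List.Relation.Unary.All.Properties using (¬All⇒Any¬; all-filter)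
open import Data.List.Extrema.Nat using (argmin; argmin-all; f[argmin]≤f[xs])
open import Data.List.Relation.Unary.Any using (here; satisfied)
import Data.List.Relation.Unary.Any as Any
open import Data.List.Relation.Unary.AllPairs using ([]; _∷_)
import Data.List.Relation.Unary.AllPairs as AllPairs
open import Data.List.Relation.Unary.Unique.Propositional using (Unique)
import Data.List.Relation.Unary.Unique.Propositional.Properties as Unique
open import Data.Nat using (ℕ; zero; suc; _+_; _*_; _≤_; _<_; z≤n; s≤s; _≟_; _<?_)
open import Data.Nat.Properties
open import Data.Nat.Induction using (<-wellFounded)
open import Induction.WellFounded using (Acc; acc)
open import Data.Nat.Tactic.RingSolver using (solve-∀)
open import Algebra.Properties.Semiring.Sum +-*-semiring
  using (sum; sum-cong-≗; ∑-distrib-+; *-distribˡ-sum; sum-replicate-zero)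
open import Data.Product using (Σ; ∃; ∃₂; _×_; _,_; proj₁; proj₂)
open import Data.Sum using (_⊎_; inj₁; inj₂; [_,_]′)
import Data.Sum as Sum
open import Data.Vec using (Vec; []; _∷_; lookup; replicate; _[_]%=_; _[_]≔_)
open import Data.Vec.Properties
  using ( lookup∘update; lookup∘update′; lookup∘updateAt; lookup∘updateAt′; updateAt-updateAt; updateAt-cong
        ; updateAt-id; ∷-injectiveˡ; ∷-injectiveʳ; lookup∘tabulate; tabulate∘lookup; tabulate-cong
        ; lookup-replicate; ≡-dec)
open import Function using (_∘_; _∋_)
open import Relation.Binary.Definitions using (DecidableEquality)
open import Relation.Binary.PropositionalEquality hiding ([_])
open import Relation.Nullary using (¬_; Dec; yes; no; does)
open import Relation.Nullary.Decidable using (_×-dec_; _→-dec_; ¬?; map′)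

pos≢zer : pos ≢ zer
pos≢zer ()

zer≢pos : zer ≢ pos
zer≢pos ()

zer≢neg : zer ≢ neg
zer≢neg ()

pos≢neg : pos ≢ neg
pos≢neg ()

infixr 5 _∙ₛ_

_∙ₛ_ : Sign → Sign → Sign
zer ∙ₛ b = b
neg ∙ₛ _ = neg
pos ∙ₛ _ = pos

opp-involutive : ∀ s → opp (opp s) ≡ s
opp-involutive neg = refl
opp-involutive zer = refl
opp-involutive pos = refl

opp-≢zer : ∀ {s} → s ≢ zer → opp s ≢ zer
opp-≢zer {neg} _ ()
opp-≢zer {zer} s≢0 = ⊥-elim (s≢0 refl)
opp-≢zer {pos} _ ()

opp-fixed⇒zer : ∀ {s} → s ≡ opp s → s ≡ zer
opp-fixed⇒zer {zer} _ = refl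

opp-≢ : ∀ {s} → s ≢ zer → opp s ≢ s
opp-≢ s≢0 eq = s≢0 (opp-fixed⇒zer (sym eq))

opp≡pos⇒neg : ∀ {s} → opp s ≡ pos → s ≡ neg
opp≡pos⇒neg {neg} _ = refl

opp≡neg⇒pos : ∀ {s} → opp s ≡ neg → s ≡ pos
opp≡neg⇒pos {pos} _ = refl

≢⇒≡opp : ∀ {a b} → a ≢ zer → b ≢ zer → a ≢ b → a ≡ opp b
≢⇒≡opp {neg} {pos} _ _ _ = refl
≢⇒≡opp {pos} {neg} _ _ _ = refl
≢⇒≡opp {neg} {neg} _ _ a≢b = ⊥-elim (a≢b refl)
≢⇒≡opp {pos} {pos} _ _ a≢b = ⊥-elim (a≢b refl)
≢⇒≡opp {zer} a≢0 _ _ = ⊥-elim (a≢0 refl)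
≢⇒≡opp {_} {zer} _ b≢0 _ = ⊥-elim (b≢0 refl)

∙ₛ-≢zerˡ : ∀ {a} b → a ≢ zer → a ∙ₛ b ≡ a
∙ₛ-≢zerˡ {neg} _ _ = refl
∙ₛ-≢zerˡ {zer} _ a≢0 = ⊥-elim (a≢0 refl)
∙ₛ-≢zerˡ {pos} _ _ = refl

∙ₛ-≢zerʳ : ∀ a {b} → b ≢ zer → a ∙ₛ b ≢ zer
∙ₛ-≢zerʳ neg _ ()
∙ₛ-≢zerʳ zer b≢0 = b≢0
∙ₛ-≢zerʳ pos _ ()

oppIf : Bool → Sign → Sign
oppIf true  = opp
oppIf false s = s

oppIf-involutive : ∀ b s → oppIf b (oppIf b s) ≡ s
oppIf-involutive true  = opp-involutive
oppIf-involutive false _ = refl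

oppIf-opp : ∀ b s → oppIf b (opp s) ≡ opp (oppIf b s)
oppIf-opp true  _ = refl
oppIf-opp false _ = refl

oppIf-∙ₛ : ∀ b x y → oppIf b (x ∙ₛ y) ≡ oppIf b x ∙ₛ oppIf b y
oppIf-∙ₛ true  neg _ = refl
oppIf-∙ₛ true  zer _ = refl
oppIf-∙ₛ true  pos _ = refl
oppIf-∙ₛ false _   _ = refl

oppIf-zer : ∀ b → oppIf b zer ≡ zer
oppIf-zer true  = refl
oppIf-zer false = refl

oppIf-≢zer : ∀ b {s} → s ≢ zer → oppIf b s ≢ zer
oppIf-≢zer true  = opp-≢zer
oppIf-≢zer false s≢0 = s≢0

oppIf≡zer⇒zer : ∀ b {s} → oppIf b s ≡ zer → s ≡ zer
oppIf≡zer⇒zer true  {zer} _ = refl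
oppIf≡zer⇒zer false eq = eq

Full : ∀ {m} → SignVec m → Set
Full X = ∀ i → lookup X i ≢ zer

lookup-ext : ∀ {A : Set} {m} {X Y : Vec A m} → (∀ i → lookup X i ≡ lookup Y i) → X ≡ Y
lookup-ext {X = X} {Y} X≗Y =
  trans (sym (tabulate∘lookup X)) (trans (tabulate-cong X≗Y) (tabulate∘lookup Y))

lookup-negate : ∀ {m} (X : SignVec m) i → lookup (negate X) i ≡ opp (lookup X i)
lookup-negate X = lookup∘tabulate _

lookup-compose : ∀ {m} (X Y : SignVec m) i → lookup (compose X Y) i ≡ lookup X i ∙ₛ lookup Y i
lookup-compose X Y i = trans (lookup∘tabulate _ i) (singleton (lookup X i) (lookup Y i))
  where
  singleton : ∀ a b → lookup (compose (a ∷ []) (b ∷ [])) zero ≡ a ∙ₛ b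
  singleton neg _ = refl
  singleton zer _ = refl
  singleton pos _ = refl

lookup-flipAt : ∀ {m} (j : Fin m) (X : SignVec m) i → lookup (flipAt j X) i ≡ oppIf (does (i ≟ᶠ j)) (lookup X i)
lookup-flipAt j X i rewrite (lookup (flipAt j X) i ≡ _ ∋ lookup∘tabulate _ i) with i ≟ᶠ j
... | yes _ = refl
... | no _  = refl

lookup-compose-zerˡ : ∀ {m} (X Y : SignVec m) {i} → lookup X i ≡ zer → lookup (compose X Y) i ≡ lookup Y i
lookup-compose-zerˡ X Y {i} Xi≡0 = trans (lookup-compose X Y i) (cong (_∙ₛ lookup Y i) Xi≡0)

lookup-compose-≢zerˡ : ∀ {m} (X Y : SignVec m) {i} → lookup X i ≢ zer → lookup (compose X Y) i ≡ lookup X i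
lookup-compose-≢zerˡ X Y {i} Xi≢0 = trans (lookup-compose X Y i) (∙ₛ-≢zerˡ _ Xi≢0)

compose-Full : ∀ {m} (X Y : SignVec m) → Full Y → Full (compose X Y)
compose-Full X Y full i = subst (_≢ zer) (sym (lookup-compose X Y i)) (∙ₛ-≢zerʳ (lookup X i) (full i))

negate-involutive : ∀ {m} (X : SignVec m) → negate (negate X) ≡ X
negate-involutive X = lookup-ext λ i →
  trans (lookup-negate (negate X) i) (trans (cong opp (lookup-negate X i)) (opp-involutive _))

negate-Full : ∀ {m} (X : SignVec m) → Full X → Full (negate X)
negate-Full X full i = opp-≢zer (full i) ∘ trans (sym (lookup-negate X i))

≡⇒¬Separates : ∀ {m} (X Y : SignVec m) {k} → lookup X k ≡ lookup Y k → ¬ Separates X Y k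
≡⇒¬Separates _ _ Xk≡Yk (Xk≡-Yk , Xk≢0) = Xk≢0 (opp-fixed⇒zer (trans Xk≡-Yk (cong opp (sym Xk≡Yk))))

[]%=-[]≔ : ∀ {A : Set} {m} (X : Vec A m) f {g : A → A} {a} → (X [ f ]%= g) [ f ]≔ a ≡ X [ f ]≔ a
[]%=-[]≔ X f = updateAt-updateAt f X

[]%=opp-involutive : ∀ {m} (X : SignVec m) f → (X [ f ]%= opp) [ f ]%= opp ≡ X
[]%=opp-involutive X f = trans (updateAt-updateAt f X) (trans (updateAt-cong f opp-involutive X) (updateAt-id f X))

≡compose-[]≔zer : ∀ {m} (X P : SignVec m) {e} → Full X → lookup X e ≡ lookup P e →
                  X ≡ compose (X [ e ]≔ zer) P
≡compose-[]≔zer X P {e} full Xe≡Pe = lookup-ext λ k → at k (k ≟ᶠ e)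
  where
  at : ∀ k → Dec (k ≡ e) → lookup X k ≡ lookup (compose (X [ e ]≔ zer) P) k
  at k (yes refl) = trans Xe≡Pe (sym (lookup-compose-zerˡ (X [ e ]≔ zer) P (lookup∘update e X zer)))
  at k (no k≢e)   =
    sym (trans (lookup-compose-≢zerˡ (X [ e ]≔ zer) P (subst (_≢ zer) (sym X[e]≔0k) (full k))) X[e]≔0k)
    where
    X[e]≔0k : lookup (X [ e ]≔ zer) k ≡ lookup X k
    X[e]≔0k = lookup∘update′ k≢e X zer

[]≔zer-compose : ∀ {m} (Y P : SignVec m) {e} → lookup Y e ≡ zer → (∀ k → k ≢ e → lookup Y k ≢ zer) →
                 compose Y P [ e ]≔ zer ≡ Y
[]≔zer-compose Y P {e} Ye≡0 Y≢0 = lookup-ext λ k → at k (k ≟ᶠ e)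
  where
  at : ∀ k → Dec (k ≡ e) → lookup (compose Y P [ e ]≔ zer) k ≡ lookup Y k
  at k (yes refl) = trans (lookup∘update e (compose Y P) zer) (sym Ye≡0)
  at k (no k≢e)   = trans (lookup∘update′ k≢e (compose Y P) zer) (lookup-compose-≢zerˡ Y P (Y≢0 k k≢e))

[]%=opp≡compose : ∀ {m} (X : SignVec m) {f} → Full X → X [ f ]%= opp ≡ compose (X [ f ]≔ zer) (negate X)
[]%=opp≡compose X {f} full = lookup-ext λ k → at k (k ≟ᶠ f)
  where
  at : ∀ k → Dec (k ≡ f) → lookup (X [ f ]%= opp) k ≡ lookup (compose (X [ f ]≔ zer) (negate X)) k
  at k (yes refl) = trans (lookup∘updateAt f X)
    (sym (trans (lookup-compose-zerˡ (X [ f ]≔ zer) (negate X) (lookup∘update f X zer)) (lookup-negate X f)))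
  at k (no k≢f) = trans (lookup∘updateAt′ k f k≢f X)
    (sym (trans (lookup-compose-≢zerˡ (X [ f ]≔ zer) (negate X) (subst (_≢ zer) (sym X[f]≔0k) (full k))) X[f]≔0k))
    where
    X[f]≔0k : lookup (X [ f ]≔ zer) k ≡ lookup X k
    X[f]≔0k = lookup∘update′ k≢f X zer

negate-[]≔zer : ∀ {m} (X : SignVec m) f → negate X [ f ]≔ zer ≡ negate (X [ f ]≔ zer)
negate-[]≔zer X f = lookup-ext λ k → at k (k ≟ᶠ f)
  where
  at : ∀ k → Dec (k ≡ f) → lookup (negate X [ f ]≔ zer) k ≡ lookup (negate (X [ f ]≔ zer)) k
  at k (yes refl) = trans (lookup∘update f (negate X) zer)
                          (sym (trans (lookup-negate (X [ f ]≔ zer) f) (cong opp (lookup∘update f X zer))))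
  at k (no k≢f) = trans (lookup∘update′ k≢f (negate X) zer) (trans (lookup-negate X k)
                    (sym (trans (lookup-negate (X [ f ]≔ zer) k) (cong opp (lookup∘update′ k≢f X zer)))))

infix 4 _≟ᵥ_ _∈L?_

_≟ᵥ_ : ∀ {m} → DecidableEquality (SignVec m)
_≟ᵥ_ = ≡-dec _≟ₛ_

_∈L?_ : ∀ {m} (X : SignVec m) (L : SignSet m) → Dec (X ∈L L)
X ∈L? L = L X Bool.≟ true

infix 4 _∈ᵥ?_

_∈ᵥ?_ : ∀ {m} (X : SignVec m) (xs : List (SignVec m)) → Dec (X ∈ xs)
X ∈ᵥ? xs = Any.any? (X ≟ᵥ_) xs

allSignVecs : ∀ m → List (SignVec m)
allSignVecs zero    = [ [] ]
allSignVecs (suc m) =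
  map (neg ∷_) (allSignVecs m) ++ map (zer ∷_) (allSignVecs m) ++ map (pos ∷_) (allSignVecs m)

∈-allSignVecs : ∀ {m} (X : SignVec m) → X ∈ allSignVecs m
∈-allSignVecs [] = here refl
∈-allSignVecs {suc m} (neg ∷ X) = ∈-++⁺ˡ (∈-map⁺ (neg ∷_) (∈-allSignVecs X))
∈-allSignVecs {suc m} (zer ∷ X) =
  ∈-++⁺ʳ (map (neg ∷_) (allSignVecs m)) (∈-++⁺ˡ (∈-map⁺ (zer ∷_) (∈-allSignVecs X)))
∈-allSignVecs {suc m} (pos ∷ X) =
  ∈-++⁺ʳ (map (neg ∷_) (allSignVecs m))
         (∈-++⁺ʳ (map (zer ∷_) (allSignVecs m)) (∈-map⁺ (pos ∷_) (∈-allSignVecs X)))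

allSignVecs-Unique : ∀ m → Unique (allSignVecs m)
allSignVecs-Unique zero = [] ∷ []
allSignVecs-Unique (suc m) =
  Unique.++⁺ (unique neg) (Unique.++⁺ (unique zer) (unique pos) λ (z , p) → zer≢pos (heads z p))
    λ (n , zp) → [ (λ z → zer≢neg (heads z n)) , (λ p → pos≢neg (heads p n)) ]′
                   (∈-++⁻ (map (zer ∷_) (allSignVecs m)) zp)
  where
  unique : ∀ s → Unique (map (s ∷_) (allSignVecs m))
  unique s = Unique.map⁺ ∷-injectiveʳ (allSignVecs-Unique m)
  heads : ∀ {s t X} → X ∈ map (s ∷_) (allSignVecs m) → X ∈ map (t ∷_) (allSignVecs m) → s ≡ t
  heads p q with ∈-map⁻ _ p | ∈-map⁻ _ q
  ... | _ , _ , refl | _ , _ , eq = ∷-injectiveˡ eq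

sublists : ∀ {A : Set} → List A → List (List A)
sublists []       = [ [] ]
sublists (x ∷ xs) = map (x ∷_) (sublists xs) ++ sublists xs

filter∈sublists : ∀ {A : Set} {P : A → Set} (P? : ∀ x → Dec (P x)) xs → filter P? xs ∈ sublists xs
filter∈sublists P? []       = here refl
filter∈sublists P? (x ∷ xs) with P? x
... | yes _ = ∈-++⁺ˡ (∈-map⁺ (x ∷_) (filter∈sublists P? xs))
... | no _  = ∈-++⁺ʳ (map (x ∷_) (sublists xs)) (filter∈sublists P? xs)

∀ₛ? : ∀ {m} {P : SignVec m → Set} → (∀ X → Dec (P X)) → Dec (∀ X → P X)
∀ₛ? {m} P? = map′ (λ all X → All.lookup all (∈-allSignVecs X)) (λ ∀P → All.tabulate λ {X} _ → ∀P X)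
                  (All.all? P? (allSignVecs m))

¬∀⇒∃¬ₛ : ∀ {m} {P : SignVec m → Set} → (∀ X → Dec (P X)) → ¬ (∀ X → P X) → ∃ λ X → ¬ P X
¬∀⇒∃¬ₛ {m} P? ¬∀P =
  satisfied (¬All⇒Any¬ P? (allSignVecs m) λ all → ¬∀P λ X → All.lookup all (∈-allSignVecs X))

SuppSub? : ∀ {m} (X Y : SignVec m) → Dec (SuppSub X Y)
SuppSub? X Y = Fin.all? λ i → ¬? (lookup X i ≟ₛ zer) →-dec ¬? (lookup Y i ≟ₛ zer)

IsTope? : ∀ {m} (L : SignSet m) T → Dec (IsTope L T)
IsTope? L T = T ∈L? L ×-dec ∀ₛ? λ Y → Y ∈L? L →-dec SuppSub? T Y →-dec SuppSub? Y T

𝟙[_] : ∀ {P : Set} → Dec P → ℕ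
𝟙[ d ] = if does d then 1 else 0

𝟙-yes : ∀ {P : Set} (d : Dec P) → P → 𝟙[ d ] ≡ 1
𝟙-yes (yes _) _ = refl
𝟙-yes (no ¬p) p = ⊥-elim (¬p p)

𝟙-no : ∀ {P : Set} (d : Dec P) → ¬ P → 𝟙[ d ] ≡ 0
𝟙-no (yes p) ¬p = ⊥-elim (¬p p)
𝟙-no (no _)  _  = refl

𝟙-mono : ∀ {P Q : Set} (d : Dec P) (d′ : Dec Q) → (P → Q) → 𝟙[ d ] ≤ 𝟙[ d′ ]
𝟙-mono (yes p) (yes _) _ = ≤-refl
𝟙-mono (yes p) (no ¬q) f = ⊥-elim (¬q (f p))
𝟙-mono (no _)  _       _ = z≤n

𝟙-cong : ∀ {P Q : Set} (d : Dec P) (d′ : Dec Q) → (P → Q) → (Q → P) → 𝟙[ d ] ≡ 𝟙[ d′ ]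
𝟙-cong d d′ f g = ≤-antisym (𝟙-mono d d′ f) (𝟙-mono d′ d g)

𝟙-× : ∀ {P Q : Set} (d : Dec P) (d′ : Dec Q) → 𝟙[ d ×-dec d′ ] ≡ 𝟙[ d ] * 𝟙[ d′ ]
𝟙-× (yes _) (yes _) = refl
𝟙-× (yes _) (no _)  = refl
𝟙-× (no _)  _       = refl

sum-mono-≤ : ∀ {n} {f g : Fin n → ℕ} → (∀ i → f i ≤ g i) → sum f ≤ sum g
sum-mono-≤ {zero}  _   = z≤n
sum-mono-≤ {suc n} f≤g = +-mono-≤ (f≤g zero) (sum-mono-≤ (f≤g ∘ suc))

sum-mono-< : ∀ {n} {f g : Fin n → ℕ} → (∀ i → f i ≤ g i) → ∀ k → f k < g k → sum f < sum g
sum-mono-< f≤g zero    fk<gk = +-mono-<-≤ fk<gk (sum-mono-≤ (f≤g ∘ suc))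
sum-mono-< f≤g (suc k) fk<gk = +-mono-≤-< (f≤g zero) (sum-mono-< (f≤g ∘ suc) k fk<gk)

sum-𝟙-≡ : ∀ {n} (k : Fin n) → sum (λ i → 𝟙[ i ≟ᶠ k ]) ≡ 1
sum-𝟙-≡ {suc n} zero    = cong suc (sum-replicate-zero n)
sum-𝟙-≡ {suc n} (suc k) = sum-𝟙-≡ k

balance : ∀ a b → a + b ≡ 2 → a + 2 * 𝟙[ a ≟ 0 ] ≡ b + 2 * 𝟙[ b ≟ 0 ]
balance 0 2 _ = refl
balance 1 1 _ = refl
balance 2 0 _ = refl
balance 0 0 ()
balance 0 1 ()
balance 0 (suc (suc (suc _))) ()
balance 1 0 ()
balance 1 (suc (suc _)) ()
balance 2 (suc _) ()
balance (suc (suc (suc _))) _ ()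

balance-on : ∀ {P : Set} (d : Dec P) a b → (P → a + b ≡ 2) →
             𝟙[ d ] * a + 2 * 𝟙[ d ×-dec a ≟ 0 ] ≡ 𝟙[ d ] * b + 2 * 𝟙[ d ×-dec b ≟ 0 ]
balance-on (yes p) a b a+b≡2 rewrite +-identityʳ a | +-identityʳ b = balance a b (a+b≡2 p)
balance-on (no _)  _ _ _     = refl

∑ₛ : ∀ {m} → (SignVec m → ℕ) → ℕ
∑ₛ {zero}  g = g []
∑ₛ {suc m} g = ∑ₛ (g ∘ (neg ∷_)) + (∑ₛ (g ∘ (zer ∷_)) + ∑ₛ (g ∘ (pos ∷_)))

∑ₛ-cong : ∀ {m} {g h : SignVec m → ℕ} → (∀ X → g X ≡ h X) → ∑ₛ g ≡ ∑ₛ h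
∑ₛ-cong {zero}  g≗h = g≗h []
∑ₛ-cong {suc m} g≗h =
  cong₂ _+_ (∑ₛ-cong (g≗h ∘ (neg ∷_)))
            (cong₂ _+_ (∑ₛ-cong (g≗h ∘ (zer ∷_))) (∑ₛ-cong (g≗h ∘ (pos ∷_))))

∑ₛ-zero : ∀ m → ∑ₛ {m} (λ _ → 0) ≡ 0
∑ₛ-zero zero = refl
∑ₛ-zero (suc m) rewrite ∑ₛ-zero m = refl

∑ₛ-distrib-+ : ∀ {m} (g h : SignVec m → ℕ) → ∑ₛ (λ X → g X + h X) ≡ ∑ₛ g + ∑ₛ h
∑ₛ-distrib-+ {zero}  g h = refl
∑ₛ-distrib-+ {suc m} g h
  rewrite ∑ₛ-distrib-+ (g ∘ (neg ∷_)) (h ∘ (neg ∷_))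
        | ∑ₛ-distrib-+ (g ∘ (zer ∷_)) (h ∘ (zer ∷_))
        | ∑ₛ-distrib-+ (g ∘ (pos ∷_)) (h ∘ (pos ∷_)) =
  interchange (∑ₛ (g ∘ (neg ∷_))) (∑ₛ (g ∘ (zer ∷_))) (∑ₛ (g ∘ (pos ∷_)))
              (∑ₛ (h ∘ (neg ∷_))) (∑ₛ (h ∘ (zer ∷_))) (∑ₛ (h ∘ (pos ∷_)))
  where
  interchange : ∀ a b c a′ b′ c′ →
                (a + a′) + ((b + b′) + (c + c′)) ≡ (a + (b + c)) + (a′ + (b′ + c′))
  interchange = solve-∀

∑ₛ-distribˡ-* : ∀ {m} c (g : SignVec m → ℕ) → ∑ₛ (λ X → c * g X) ≡ c * ∑ₛ g
∑ₛ-distribˡ-* {zero}  c g = refl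
∑ₛ-distribˡ-* {suc m} c g
  rewrite ∑ₛ-distribˡ-* c (g ∘ (neg ∷_))
        | ∑ₛ-distribˡ-* c (g ∘ (zer ∷_))
        | ∑ₛ-distribˡ-* c (g ∘ (pos ∷_)) =
  trans (cong (c * ∑ₛ (g ∘ (neg ∷_)) +_) (sym (*-distribˡ-+ c _ _))) (sym (*-distribˡ-+ c _ _))

∑ₛ-mono-≤ : ∀ {m} {g h : SignVec m → ℕ} → (∀ X → g X ≤ h X) → ∑ₛ g ≤ ∑ₛ h
∑ₛ-mono-≤ {zero}  g≤h = g≤h []
∑ₛ-mono-≤ {suc m} g≤h =
  +-mono-≤ (∑ₛ-mono-≤ (g≤h ∘ (neg ∷_)))
           (+-mono-≤ (∑ₛ-mono-≤ (g≤h ∘ (zer ∷_))) (∑ₛ-mono-≤ (g≤h ∘ (pos ∷_))))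

∑ₛ-mono-< : ∀ {m} {g h : SignVec m → ℕ} → (∀ X → g X ≤ h X) → ∀ A → g A < h A → ∑ₛ g < ∑ₛ h
∑ₛ-mono-< {zero} g≤h [] gA<hA = gA<hA
∑ₛ-mono-< {suc m} g≤h (neg ∷ A) gA<hA =
  +-mono-<-≤ (∑ₛ-mono-< (g≤h ∘ (neg ∷_)) A gA<hA)
             (+-mono-≤ (∑ₛ-mono-≤ (g≤h ∘ (zer ∷_))) (∑ₛ-mono-≤ (g≤h ∘ (pos ∷_))))
∑ₛ-mono-< {suc m} g≤h (zer ∷ A) gA<hA =
  +-mono-≤-< (∑ₛ-mono-≤ (g≤h ∘ (neg ∷_)))
             (+-mono-<-≤ (∑ₛ-mono-< (g≤h ∘ (zer ∷_)) A gA<hA) (∑ₛ-mono-≤ (g≤h ∘ (pos ∷_))))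
∑ₛ-mono-< {suc m} g≤h (pos ∷ A) gA<hA =
  +-mono-≤-< (∑ₛ-mono-≤ (g≤h ∘ (neg ∷_)))
             (+-mono-≤-< (∑ₛ-mono-≤ (g≤h ∘ (zer ∷_))) (∑ₛ-mono-< (g≤h ∘ (pos ∷_)) A gA<hA))

∑ₛ-single : ∀ {m} (A : SignVec m) (g : SignVec m → ℕ) → (∀ X → X ≢ A → g X ≡ 0) → ∑ₛ g ≡ g A
∑ₛ-single [] g _ = refl
∑ₛ-single {suc m} (a ∷ A) g vanish = split a refl
  where
  elsewhere : ∀ s → s ≢ a → ∑ₛ (g ∘ (s ∷_)) ≡ 0
  elsewhere s s≢a = trans (∑ₛ-cong λ X → vanish (s ∷ X) (s≢a ∘ ∷-injectiveˡ)) (∑ₛ-zero m)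
  at-a : ∑ₛ (g ∘ (a ∷_)) ≡ g (a ∷ A)
  at-a = ∑ₛ-single A (g ∘ (a ∷_)) λ X X≢A → vanish (a ∷ X) (X≢A ∘ ∷-injectiveʳ)
  split : ∀ s → s ≡ a → ∑ₛ g ≡ g (a ∷ A)
  split neg refl rewrite elsewhere zer (λ ()) | elsewhere pos (λ ()) = trans (+-identityʳ _) at-a
  split zer refl rewrite elsewhere neg (λ ()) | elsewhere pos (λ ()) = trans (+-identityʳ _) at-a
  split pos refl rewrite elsewhere neg (λ ()) | elsewhere zer (λ ()) = at-a

∑ₛ-𝟙-single : ∀ {m} (A : SignVec m) → ∑ₛ (λ X → 𝟙[ X ≟ᵥ A ]) ≡ 1
∑ₛ-𝟙-single A = trans (∑ₛ-single A _ λ X → 𝟙-no (X ≟ᵥ A)) (𝟙-yes (A ≟ᵥ A) refl)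

∑ₛ-𝟙-pair : ∀ {m} {P : SignVec m → Set} (P? : ∀ X → Dec (P X)) {A B} → A ≢ B →
            (∀ X → P X → X ≡ A ⊎ X ≡ B) → P A → P B → ∑ₛ (λ X → 𝟙[ P? X ]) ≡ 2
∑ₛ-𝟙-pair P? {A} {B} A≢B only PA PB = begin
  ∑ₛ (λ X → 𝟙[ P? X ])                              ≡⟨ ∑ₛ-cong split ⟩
  ∑ₛ (λ X → 𝟙[ X ≟ᵥ A ] + 𝟙[ X ≟ᵥ B ])
    ≡⟨ ∑ₛ-distrib-+ (λ X → 𝟙[ X ≟ᵥ A ]) (λ X → 𝟙[ X ≟ᵥ B ]) ⟩
  ∑ₛ (λ X → 𝟙[ X ≟ᵥ A ]) + ∑ₛ (λ X → 𝟙[ X ≟ᵥ B ])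
    ≡⟨ cong₂ _+_ (∑ₛ-𝟙-single A) (∑ₛ-𝟙-single B) ⟩
  2                                                 ∎
  where
  open ≡-Reasoning
  split : ∀ X → 𝟙[ P? X ] ≡ 𝟙[ X ≟ᵥ A ] + 𝟙[ X ≟ᵥ B ]
  split X with X ≟ᵥ A | X ≟ᵥ B
  ... | yes refl | yes refl = ⊥-elim (A≢B refl)
  ... | yes refl | no _     = 𝟙-yes (P? X) PA
  ... | no _     | yes refl = 𝟙-yes (P? X) PB
  ... | no X≢A   | no X≢B   = 𝟙-no (P? X) λ PX → [ X≢A , X≢B ]′ (only X PX)

∑ₛ-𝟙-≡ : ∀ {m} (A : SignVec m) (g : SignVec m → ℕ) → ∑ₛ (λ X → 𝟙[ X ≟ᵥ A ] * g X) ≡ g A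
∑ₛ-𝟙-≡ A g = trans (∑ₛ-single A _ λ X X≢A → cong (_* g X) (𝟙-no (X ≟ᵥ A) X≢A))
                   (trans (cong (_* g A) (𝟙-yes (A ≟ᵥ A) refl)) (+-identityʳ (g A)))

private
  rotate : ∀ a b c → a + (b + c) ≡ c + (b + a)
  rotate = solve-∀

∑ₛ-%=opp : ∀ {m} (j : Fin m) (g : SignVec m → ℕ) → ∑ₛ (λ X → g (X [ j ]%= opp)) ≡ ∑ₛ g
∑ₛ-%=opp zero    g = rotate (∑ₛ (g ∘ (pos ∷_))) (∑ₛ (g ∘ (zer ∷_))) (∑ₛ (g ∘ (neg ∷_)))
∑ₛ-%=opp (suc j) g =
  cong₂ _+_ (∑ₛ-%=opp j _) (cong₂ _+_ (∑ₛ-%=opp j _) (∑ₛ-%=opp j _))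

∑ₛ-negate : ∀ {m} (g : SignVec m → ℕ) → ∑ₛ (g ∘ negate) ≡ ∑ₛ g
∑ₛ-negate {zero}  g = refl
∑ₛ-negate {suc m} g
  rewrite ∑ₛ-negate (g ∘ (pos ∷_)) | ∑ₛ-negate (g ∘ (zer ∷_)) | ∑ₛ-negate (g ∘ (neg ∷_)) =
  rotate (∑ₛ (g ∘ (pos ∷_))) (∑ₛ (g ∘ (zer ∷_))) (∑ₛ (g ∘ (neg ∷_)))

∑ₛ-sum-comm : ∀ {m} n (h : SignVec m → Fin n → ℕ) →
              ∑ₛ (λ X → sum (h X)) ≡ sum (λ f → ∑ₛ (λ X → h X f))
∑ₛ-sum-comm {m} zero    h = ∑ₛ-zero m
∑ₛ-sum-comm     (suc n) h =
  trans (∑ₛ-distrib-+ (λ X → h X zero) (λ X → sum (h X ∘ suc)))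
        (cong (∑ₛ (λ X → h X zero) +_) (∑ₛ-sum-comm n λ X → h X ∘ suc))

𝟙-∈-∷ : ∀ {m} {X y : SignVec m} {ys} → y ∉ ys →
        𝟙[ X ∈ᵥ? (y ∷ ys) ] ≡ 𝟙[ X ≟ᵥ y ] + 𝟙[ X ∈ᵥ? ys ]
𝟙-∈-∷ {X = X} {y} {ys} y∉ys with X ≟ᵥ y
... | yes refl = cong suc (sym (𝟙-no (X ∈ᵥ? ys) y∉ys))
... | no _     = refl

length-filter : ∀ {m} {P : SignVec m → Set} (P? : ∀ X → Dec (P X)) {xs} → Unique xs →
                length (filter P? xs) ≡ ∑ₛ (λ X → 𝟙[ X ∈ᵥ? xs ] * 𝟙[ P? X ])
length-filter {m} P? {[]} _ = sym (∑ₛ-zero m)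
length-filter P? {y ∷ ys} (y∉ys ∷ unique) = begin
  length (filter P? (y ∷ ys))
    ≡⟨ length-filter-∷ ⟩
  𝟙[ P? y ] + length (filter P? ys)
    ≡⟨ cong₂ _+_ (sym (∑ₛ-𝟙-≡ y (𝟙[_] ∘ P?))) (length-filter P? unique) ⟩
  ∑ₛ (λ X → 𝟙[ X ≟ᵥ y ] * 𝟙[ P? X ]) + ∑ₛ (λ X → 𝟙[ X ∈ᵥ? ys ] * 𝟙[ P? X ])
    ≡⟨ ∑ₛ-distrib-+ (λ X → 𝟙[ X ≟ᵥ y ] * 𝟙[ P? X ]) (λ X → 𝟙[ X ∈ᵥ? ys ] * 𝟙[ P? X ]) ⟨
  ∑ₛ (λ X → 𝟙[ X ≟ᵥ y ] * 𝟙[ P? X ] + 𝟙[ X ∈ᵥ? ys ] * 𝟙[ P? X ])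
    ≡⟨ ∑ₛ-cong (λ X → trans (sym (*-distribʳ-+ 𝟙[ P? X ] 𝟙[ X ≟ᵥ y ] 𝟙[ X ∈ᵥ? ys ]))
                            (cong (_* 𝟙[ P? X ]) (sym (𝟙-∈-∷ {X = X} y∉ys′)))) ⟩
  ∑ₛ (λ X → 𝟙[ X ∈ᵥ? (y ∷ ys) ] * 𝟙[ P? X ]) ∎
  where
  open ≡-Reasoning
  y∉ys′ : y ∉ ys
  y∉ys′ y∈ys = All.lookup y∉ys y∈ys refl
  length-filter-∷ : length (filter P? (y ∷ ys)) ≡ 𝟙[ P? y ] + length (filter P? ys)
  length-filter-∷ with P? y
  ... | yes _ = refl
  ... | no _  = refl

length≡∑ₛ : ∀ {m} {xs : List (SignVec m)} → Unique xs → length xs ≡ ∑ₛ (λ X → 𝟙[ X ∈ᵥ? xs ])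
length≡∑ₛ {m} {xs} unique =
  trans (sym (length-filter-all xs))
        (trans (length-filter (λ _ → yes tt) unique) (∑ₛ-cong {m} λ X → *-identityʳ _))
  where
  length-filter-all : ∀ ys → length (filter (λ (_ : SignVec _) → yes tt) ys) ≡ length ys
  length-filter-all [] = refl
  length-filter-all (_ ∷ ys) = cong suc (length-filter-all ys)

-- Lightest tope committees are critical

module _ {m : ℕ} where

  weight : SignVec m → ℕ
  weight X = suc (sum λ i → 𝟙[ lookup X i ≟ₛ pos ])

  totalWeight : List (SignVec m) → ℕ
  totalWeight S = ∑ₛ λ X → 𝟙[ X ∈ᵥ? S ] * weight X

  ProperSubset⇒totalWeight< : ∀ {S Ks} → ProperSubset S Ks → totalWeight S < totalWeight Ks
  ProperSubset⇒totalWeight< {S} {Ks} (S⊆Ks , K , K∈Ks , K∉S) =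
    ∑ₛ-mono-< (λ X → *-monoˡ-≤ (weight X) (𝟙-mono (X ∈ᵥ? S) (X ∈ᵥ? Ks) (All.lookup S⊆Ks))) K
      (subst₂ _<_ (sym (cong (_* weight K) (𝟙-no (K ∈ᵥ? S) K∉S)))
                  (sym (trans (cong (_* weight K) (𝟙-yes (K ∈ᵥ? Ks) K∈Ks)) (+-identityʳ _))) (s≤s z≤n))

  PlusProperSub⇒weight< : ∀ {T K} → PlusProperSub T K → weight T < weight K
  PlusProperSub⇒weight< {T} {K} (T⁺⊆K⁺ , i , Ki≡pos , Ti≢pos) =
    s≤s (sum-mono-< (λ j → 𝟙-mono (lookup T j ≟ₛ pos) (lookup K j ≟ₛ pos) (T⁺⊆K⁺ j)) i
      (subst₂ _<_ (sym (𝟙-no (lookup T i ≟ₛ pos) Ti≢pos)) (sym (𝟙-yes (lookup K i ≟ₛ pos) Ki≡pos))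
                  (s≤s z≤n)))

  ListsSwap-𝟙 : ∀ {Ks : List (SignVec m)} {K T S} → K ∈ Ks → T ≢ K → ListsSwap Ks K T S →
                ∀ X → 𝟙[ X ∈ᵥ? S ] + 𝟙[ X ≟ᵥ K ] ≤ 𝟙[ X ∈ᵥ? Ks ] + 𝟙[ X ≟ᵥ T ]
  ListsSwap-𝟙 {Ks} {K} {T} {S} K∈Ks T≢K swap X with X ∈ᵥ? S | X ≟ᵥ K
  ... | no _    | no _     = z≤n
  ... | no _    | yes refl =
    subst (1 ≤_) (sym (cong (_+ 𝟙[ X ≟ᵥ T ]) (𝟙-yes (X ∈ᵥ? Ks) K∈Ks))) (s≤s z≤n)
  ... | yes X∈S | X≟K with proj₁ (swap X) X∈S
  ...   | inj₁ (X∈Ks , X≢K) = subst₂ _≤_ (cong suc (sym (𝟙-no X≟K X≢K)))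
                                       (cong (_+ 𝟙[ X ≟ᵥ T ]) (sym (𝟙-yes (X ∈ᵥ? Ks) X∈Ks))) (s≤s z≤n)
  ...   | inj₂ refl         = subst₂ _≤_ (cong suc (sym (𝟙-no X≟K T≢K)))
                                       (cong (𝟙[ T ∈ᵥ? Ks ] +_) (sym (𝟙-yes (T ≟ᵥ T) refl))) (m≤n+m 1 _)

  ListsSwap⇒totalWeight< : ∀ {Ks K T S} → K ∈ Ks → PlusProperSub T K → ListsSwap Ks K T S →
                           totalWeight S < totalWeight Ks
  ListsSwap⇒totalWeight< {Ks} {K} {T} {S} K∈Ks T⁺⊂K⁺@(_ , _ , Ki≡pos , Ti≢pos) swap =
    +-cancelʳ-< (weight K) (totalWeight S) (totalWeight Ks) (begin-strict
      totalWeight S + weight K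
        ≡⟨ cong (totalWeight S +_) (∑ₛ-𝟙-≡ K weight) ⟨
      totalWeight S + ∑ₛ (λ X → 𝟙[ X ≟ᵥ K ] * weight X)
        ≡⟨ ∑ₛ-distrib-+ (λ X → 𝟙[ X ∈ᵥ? S ] * weight X) (λ X → 𝟙[ X ≟ᵥ K ] * weight X) ⟨
      ∑ₛ (λ X → 𝟙[ X ∈ᵥ? S ] * weight X + 𝟙[ X ≟ᵥ K ] * weight X)
        ≤⟨ ∑ₛ-mono-≤ (λ X → subst₂ _≤_ (*-distribʳ-+ (weight X) 𝟙[ X ∈ᵥ? S ] 𝟙[ X ≟ᵥ K ])
                                       (*-distribʳ-+ (weight X) 𝟙[ X ∈ᵥ? Ks ] 𝟙[ X ≟ᵥ T ])
                                       (*-monoˡ-≤ (weight X) (ListsSwap-𝟙 K∈Ks T≢K swap X))) ⟩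
      ∑ₛ (λ X → 𝟙[ X ∈ᵥ? Ks ] * weight X + 𝟙[ X ≟ᵥ T ] * weight X)
        ≡⟨ ∑ₛ-distrib-+ (λ X → 𝟙[ X ∈ᵥ? Ks ] * weight X) (λ X → 𝟙[ X ≟ᵥ T ] * weight X) ⟩
      totalWeight Ks + ∑ₛ (λ X → 𝟙[ X ≟ᵥ T ] * weight X)
        ≡⟨ cong (totalWeight Ks +_) (∑ₛ-𝟙-≡ T weight) ⟩
      totalWeight Ks + weight T
        <⟨ +-monoʳ-< (totalWeight Ks) (PlusProperSub⇒weight< {T} {K} T⁺⊂K⁺) ⟩
      totalWeight Ks + weight K ∎)
    where
    open ≤-Reasoning
    T≢K : T ≢ K
    T≢K refl = Ti≢pos Ki≡pos

IsTopeCommittee? : ∀ {m} (L : SignSet m) S → Dec (IsTopeCommittee L S)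
IsTopeCommittee? L S =
  AllPairs.allPairs? (λ X Y → ¬? (X ≟ᵥ Y)) S ×-dec All.all? (IsTope? L) S ×-dec
  Fin.all? (λ e → length S <? 2 * countPos e S)

module _ {m} {L : SignSet m} where

  committee-normal-form : ∀ {S} → IsTopeCommittee L S →
                          ∃ λ S′ → S′ ∈ sublists (allSignVecs m) × IsTopeCommittee L S′ ×
                                   totalWeight S′ ≡ totalWeight S
  committee-normal-form {S} (S-Unique , S-topes , S-majority) =
    S′ , filter∈sublists (_∈ᵥ? S) (allSignVecs m) ,
    (S′-Unique , All.tabulate (All.lookup S-topes ∘ S′⊆S) ,
     λ e → subst₂ _<_ (sym length≡) (cong (2 *_) (sym (countPos≡ e))) (S-majority e)) ,
    ∑ₛ-cong (λ X → cong (_* weight X) (same X))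
    where
    S′ : List (SignVec m)
    S′ = filter (_∈ᵥ? S) (allSignVecs m)
    S′-Unique : Unique S′
    S′-Unique = Unique.filter⁺ (_∈ᵥ? S) (allSignVecs-Unique m)
    S′⊆S : ∀ {X} → X ∈ S′ → X ∈ S
    S′⊆S = proj₂ ∘ ∈-filter⁻ (_∈ᵥ? S) {xs = allSignVecs m}
    same : ∀ X → 𝟙[ X ∈ᵥ? S′ ] ≡ 𝟙[ X ∈ᵥ? S ]
    same X = 𝟙-cong (X ∈ᵥ? S′) (X ∈ᵥ? S) S′⊆S (∈-filter⁺ (_∈ᵥ? S) (∈-allSignVecs X))
    length≡ : length S′ ≡ length S
    length≡ = trans (length≡∑ₛ S′-Unique) (trans (∑ₛ-cong same) (sym (length≡∑ₛ S-Unique)))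
    countPos≡ : ∀ e → countPos e S′ ≡ countPos e S
    countPos≡ e = trans (length-filter (λ K → lookup K e ≟ₛ pos) S′-Unique)
      (trans (∑ₛ-cong (λ X → cong (_* 𝟙[ lookup X e ≟ₛ pos ]) (same X)))
             (sym (length-filter (λ K → lookup K e ≟ₛ pos) S-Unique)))

  lightest-committee : ∀ {C₀} → IsTopeCommittee L C₀ →
                       ∃ λ C → IsTopeCommittee L C ×
                               (∀ S → IsTopeCommittee L S → totalWeight C ≤ totalWeight S)
  lightest-committee {C₀} C₀-committee =
    C , argmin-all totalWeight C₀-committee (all-filter (IsTopeCommittee? L) candidates) , lightest
    where
    candidates committees : List (List (SignVec m))
    candidates = sublists (allSignVecs m)
    committees = filter (IsTopeCommittee? L) candidates
    C : List (SignVec m)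
    C = argmin totalWeight C₀ committees
    lightest : ∀ S → IsTopeCommittee L S → totalWeight C ≤ totalWeight S
    lightest S S-committee with committee-normal-form S-committee
    ... | S′ , S′∈ , S′-committee , weight≡ =
      subst (totalWeight C ≤_) weight≡
        (All.lookup (f[argmin]≤f[xs] C₀ committees) (∈-filter⁺ (IsTopeCommittee? L) S′∈ S′-committee))

  lightest⇒critical : ∀ {C} → IsTopeCommittee L C →
                      (∀ S → IsTopeCommittee L S → totalWeight C ≤ totalWeight S) →
                      IsCriticalTopeCommittee L C
  lightest⇒critical C-committee lightest =
    (C-committee , λ S _ S⊂C S-committee → <⇒≱ (ProperSubset⇒totalWeight< S⊂C) (lightest S S-committee)) ,
    λ K T K∈C _ T⁺⊂K⁺ S _ swap S-committee →
      <⇒≱ (ListsSwap⇒totalWeight< K∈C T⁺⊂K⁺ swap) (lightest S S-committee)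

  TopeCommittee⇒HasCritical : ∀ {C₀} → IsTopeCommittee L C₀ → HasCriticalTopeCommittee L
  TopeCommittee⇒HasCritical C₀-committee with lightest-committee C₀-committee
  ... | C , C-committee , lightest = C , lightest⇒critical C-committee lightest

-- Reorientation

Rank≤2 : ∀ {m} → SignSet m → Set
Rank≤2 {m} L = ∀ X → X ∈L L → ∀ {e g : Fin m} → e ≢ g →
               lookup X e ≡ zer → lookup X g ≡ zer → ∀ i → lookup X i ≡ zer

RealisesSignPairs : ∀ {m} → SignSet m → Set
RealisesSignPairs {m} L = ∀ {e f : Fin m} → e ≢ f → ∀ {a b} → a ≢ zer → b ≢ zer →
                          ∃ λ T → T ∈L L × Full T × lookup T e ≡ a × lookup T f ≡ b

record SimpleRank2 {m} (L : SignSet m) : Set where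
  field
    isOM              : IsOM L
    rank≤2            : Rank≤2 L
    realisesSignPairs : RealisesSignPairs L

module _ {m} (j : Fin m) where

  private
    flips : Fin m → Bool
    flips i = does (i ≟ᶠ j)

    lookup-flip : ∀ X i → lookup (flipAt j X) i ≡ oppIf (flips i) (lookup X i)
    lookup-flip = lookup-flipAt j

  flipAt-involutive : ∀ X → flipAt j (flipAt j X) ≡ X
  flipAt-involutive X = lookup-ext λ i → begin
    lookup (flipAt j (flipAt j X)) i          ≡⟨ lookup-flip (flipAt j X) i ⟩
    oppIf (flips i) (lookup (flipAt j X) i)   ≡⟨ cong (oppIf (flips i)) (lookup-flip X i) ⟩
    oppIf (flips i) (oppIf (flips i) _)       ≡⟨ oppIf-involutive (flips i) _ ⟩
    lookup X i                                ∎
    where open ≡-Reasoning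

  flipAt-negate : ∀ X → flipAt j (negate X) ≡ negate (flipAt j X)
  flipAt-negate X = lookup-ext λ i → begin
    lookup (flipAt j (negate X)) i            ≡⟨ lookup-flip (negate X) i ⟩
    oppIf (flips i) (lookup (negate X) i)     ≡⟨ cong (oppIf (flips i)) (lookup-negate X i) ⟩
    oppIf (flips i) (opp (lookup X i))        ≡⟨ oppIf-opp (flips i) _ ⟩
    opp (oppIf (flips i) (lookup X i))        ≡⟨ cong opp (lookup-flip X i) ⟨
    opp (lookup (flipAt j X) i)               ≡⟨ lookup-negate (flipAt j X) i ⟨
    lookup (negate (flipAt j X)) i            ∎
    where open ≡-Reasoning

  flipAt-compose : ∀ X Y → flipAt j (compose X Y) ≡ compose (flipAt j X) (flipAt j Y)
  flipAt-compose X Y = lookup-ext λ i → begin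
    lookup (flipAt j (compose X Y)) i                         ≡⟨ lookup-flip (compose X Y) i ⟩
    oppIf (flips i) (lookup (compose X Y) i)                  ≡⟨ cong (oppIf (flips i)) (lookup-compose X Y i) ⟩
    oppIf (flips i) (lookup X i ∙ₛ lookup Y i)                ≡⟨ oppIf-∙ₛ (flips i) _ _ ⟩
    oppIf (flips i) (lookup X i) ∙ₛ oppIf (flips i) (lookup Y i)
      ≡⟨ cong₂ _∙ₛ_ (lookup-flip X i) (lookup-flip Y i) ⟨
    lookup (flipAt j X) i ∙ₛ lookup (flipAt j Y) i            ≡⟨ lookup-compose (flipAt j X) (flipAt j Y) i ⟨
    lookup (compose (flipAt j X) (flipAt j Y)) i              ∎
    where open ≡-Reasoning

  flipAt-zer : ∀ X {i} → lookup X i ≡ zer → lookup (flipAt j X) i ≡ zer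
  flipAt-zer X {i} Xi≡0 = trans (lookup-flip X i) (trans (cong (oppIf (flips i)) Xi≡0) (oppIf-zer (flips i)))

  flipAt-zer⁻ : ∀ X {i} → lookup (flipAt j X) i ≡ zer → lookup X i ≡ zer
  flipAt-zer⁻ X {i} flipXi≡0 = oppIf≡zer⇒zer (flips i) (trans (sym (lookup-flip X i)) flipXi≡0)

  flipAt-Separates : ∀ X Y {f} → Separates X Y f → Separates (flipAt j X) (flipAt j Y) f
  flipAt-Separates X Y {f} (Xf≡-Yf , Xf≢0) =
    trans (lookup-flip X f) (trans (cong (oppIf (flips f)) Xf≡-Yf)
      (trans (oppIf-opp (flips f) _) (cong opp (sym (lookup-flip Y f))))) ,
    Xf≢0 ∘ flipAt-zer⁻ X

  flipAt-Separates⁻ : ∀ X Y {f} → Separates (flipAt j X) (flipAt j Y) f → Separates X Y f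
  flipAt-Separates⁻ X Y {f} sep
    with flipAt-Separates (flipAt j X) (flipAt j Y) sep
  ... | sep′ rewrite flipAt-involutive X | flipAt-involutive Y = sep′

  ∈-reorient : ∀ {L X} → X ∈L L → flipAt j X ∈L reorient j L
  ∈-reorient {L} X∈L = subst (_∈L L) (sym (flipAt-involutive _)) X∈L

  reorient-IsOM : ∀ {L} → IsOM L → IsOM (reorient j L)
  reorient-IsOM {L} om = record
    { L0 = subst (_∈L L) (sym flip-0) L0
    ; L1 = λ X X∈ → subst (_∈L L) (sym (flipAt-negate X)) (L1 _ X∈)
    ; L2 = λ X Y X∈ Y∈ → subst (_∈L L) (sym (flipAt-compose X Y)) (L2 _ _ X∈ Y∈)
    ; L3 = eliminate
    }
    where
    open IsOM om
    flip-0 : flipAt j (replicate m zer) ≡ replicate m zer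
    flip-0 = lookup-ext λ i → trans (flipAt-zer _ (lookup-replicate i zer)) (sym (lookup-replicate i zer))
    eliminate : ∀ X Y → X ∈L reorient j L → Y ∈L reorient j L → ∀ e → Separates X Y e →
                Σ (SignVec m) λ Z → Z ∈L reorient j L × lookup Z e ≡ zer ×
                  (∀ f → ¬ Separates X Y f → lookup Z f ≡ lookup (compose X Y) f)
    eliminate X Y X∈ Y∈ e sep with L3 _ _ X∈ Y∈ e (flipAt-Separates X Y sep)
    ... | Z , Z∈ , Ze≡0 , agrees =
      flipAt j Z , ∈-reorient {L} Z∈ , flipAt-zer Z Ze≡0 , λ f ¬sep → begin
        lookup (flipAt j Z) f                                ≡⟨ lookup-flip Z f ⟩
        oppIf (flips f) (lookup Z f)
          ≡⟨ cong (oppIf (flips f)) (agrees f (¬sep ∘ flipAt-Separates⁻ X Y)) ⟩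
        oppIf (flips f) (lookup (compose (flipAt j X) (flipAt j Y)) f)
          ≡⟨ cong (λ V → oppIf (flips f) (lookup V f)) (flipAt-compose X Y) ⟨
        oppIf (flips f) (lookup (flipAt j (compose X Y)) f)  ≡⟨ cong (oppIf (flips f)) (lookup-flip _ f) ⟩
        oppIf (flips f) (oppIf (flips f) _)                  ≡⟨ oppIf-involutive (flips f) _ ⟩
        lookup (compose X Y) f                               ∎
      where open ≡-Reasoning

  reorient-Rank≤2 : ∀ {L} → Rank≤2 L → Rank≤2 (reorient j L)
  reorient-Rank≤2 rank≤2 X X∈ e≢g Xe≡0 Xg≡0 i =
    flipAt-zer⁻ X (rank≤2 _ X∈ e≢g (flipAt-zer X Xe≡0) (flipAt-zer X Xg≡0) i)

  reorient-RealisesSignPairs : ∀ {L} → RealisesSignPairs L → RealisesSignPairs (reorient j L)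
  reorient-RealisesSignPairs {L} realise {e} {f} e≢f {a} {b} a≢0 b≢0
    with realise e≢f (oppIf-≢zer (flips e) a≢0) (oppIf-≢zer (flips f) b≢0)
  ... | T , T∈ , full , Te , Tf =
    flipAt j T , ∈-reorient {L} T∈ , (λ i → full i ∘ flipAt-zer⁻ T) ,
    trans (lookup-flip T e) (trans (cong (oppIf (flips e)) Te) (oppIf-involutive (flips e) a)) ,
    trans (lookup-flip T f) (trans (cong (oppIf (flips f)) Tf) (oppIf-involutive (flips f) b))

  reorient-SimpleRank2 : ∀ {L} → SimpleRank2 L → SimpleRank2 (reorient j L)
  reorient-SimpleRank2 S = record
    { isOM              = reorient-IsOM isOM
    ; rank≤2            = reorient-Rank≤2 rank≤2
    ; realisesSignPairs = reorient-RealisesSignPairs realisesSignPairs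
    }
    where open SimpleRank2 S

reorientSeq-SimpleRank2 : ∀ {m} (js : List (Fin m)) {L} → SimpleRank2 L → SimpleRank2 (reorientSeq js L)
reorientSeq-SimpleRank2 []       S = S
reorientSeq-SimpleRank2 (j ∷ js) S = reorientSeq-SimpleRank2 js (reorient-SimpleRank2 j S)

-- The hypotheses on N⁰

Conf<-compose : ∀ {m} (X Y : SignVec m) k → lookup X k ≡ zer → lookup Y k ≢ zer → Conf< X (compose X Y)
Conf<-compose X Y k Xk≡0 Yk≢0 =
  conformal , λ X≡XY → Yk≢0 (trans (sym XYk≡Yk) (trans (cong (λ V → lookup V k) (sym X≡XY)) Xk≡0))
  where
  XYk≡Yk : lookup (compose X Y) k ≡ lookup Y k
  XYk≡Yk = trans (lookup-compose X Y k) (cong (_∙ₛ lookup Y k) Xk≡0)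
  conformal : Conf≤ X (compose X Y)
  conformal i with lookup X i ≟ₛ zer
  ... | yes Xi≡0 = inj₁ Xi≡0
  ... | no Xi≢0  = inj₂ (sym (trans (lookup-compose X Y i) (∙ₛ-≢zerˡ _ Xi≢0)))

HasRank2⇒distinct : ∀ {m} {L : SignSet m} → HasRank2 L → ∃₂ λ (p q : Fin m) → p ≢ q
HasRank2⇒distinct {m} ((X₁ , X₂ , _ , _ , (_ , 0≢X₁) , (X₁≤X₂ , X₁≢X₂)) , _)
  with Fin.¬∀⟶∃¬ m _ (λ k → lookup X₁ k ≟ₛ zer)
         (λ X₁≡0 → 0≢X₁ (lookup-ext λ k → trans (lookup-replicate k zer) (sym (X₁≡0 k))))
     | Fin.¬∀⟶∃¬ m _ (λ k → lookup X₁ k ≟ₛ lookup X₂ k) (X₁≢X₂ ∘ lookup-ext)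
... | q , X₁q≢0 | p , X₁p≢X₂p with X₁≤X₂ p
...   | inj₁ X₁p≡0 = p , q , λ { refl → X₁q≢0 X₁p≡0 }
...   | inj₂ X₁p≡X₂p = ⊥-elim (X₁p≢X₂p X₁p≡X₂p)

module _ {m} {L : SignSet m} (om : IsOM L) where
  open IsOM om

  ∃-covector-zer-pos : RealisesSignPairs L → ∀ {e g : Fin m} → e ≢ g →
                       ∃ λ Z → Z ∈L L × lookup Z e ≡ zer × lookup Z g ≡ pos
  ∃-covector-zer-pos realise {e} {g} e≢g
    with realise e≢g {pos} {pos} (λ ()) (λ ()) | realise e≢g {neg} {pos} (λ ()) (λ ())
  ... | T₁ , T₁∈ , _ , T₁e , T₁g | T₂ , T₂∈ , _ , T₂e , T₂g
    with L3 T₁ T₂ T₁∈ T₂∈ e (trans T₁e (cong opp (sym T₂e)) , pos≢zer ∘ trans (sym T₁e))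
  ... | Z , Z∈ , Ze≡0 , agrees =
    Z , Z∈ , Ze≡0 , trans (agrees g ¬sep) (trans (lookup-compose T₁ T₂ g) (cong (_∙ₛ lookup T₂ g) T₁g))
    where
    ¬sep : ¬ Separates T₁ T₂ g
    ¬sep (T₁g≡-T₂g , _) with trans (sym T₁g) (trans T₁g≡-T₂g (cong opp T₂g))
    ... | ()

  module _ (acyclic : IsAcyclic L) where

    private
      T⁺ : SignVec m
      T⁺ = replicate m pos

      T⁺-Full : Full T⁺
      T⁺-Full i T⁺i≡0 with trans (sym (lookup-replicate i pos)) T⁺i≡0
      ... | ()

      Occurs : Fin m → Fin m → Sign → Sign → Set
      Occurs e f a b = ∃ λ W → W ∈L L × lookup W e ≡ a × lookup W f ≡ b

      occurs-opp : ∀ {e f a b} → Occurs e f a b → Occurs e f (opp a) (opp b)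
      occurs-opp {e} {f} (W , W∈ , We , Wf) =
        negate W , L1 W W∈ , trans (lookup-negate W e) (cong opp We) , trans (lookup-negate W f) (cong opp Wf)

      occurs-∙ₛ : ∀ {e f a b c d} → Occurs e f a b → Occurs e f c d → Occurs e f (a ∙ₛ c) (b ∙ₛ d)
      occurs-∙ₛ {e} {f} (W , W∈ , We , Wf) (W′ , W′∈ , W′e , W′f) =
        compose W W′ , L2 W W′ W∈ W′∈ ,
        trans (lookup-compose W W′ e) (cong₂ _∙ₛ_ We W′e) ,
        trans (lookup-compose W W′ f) (cong₂ _∙ₛ_ Wf W′f)

      occurs-pos-pos : ∀ {e f} → Occurs e f pos pos
      occurs-pos-pos {e} {f} = T⁺ , proj₁ acyclic , lookup-replicate e pos , lookup-replicate f pos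

      occurs-pos-neg : ∀ {e f} a b → a ≢ b → Occurs e f a b → Occurs e f pos neg
      occurs-pos-neg neg neg a≢b _ = ⊥-elim (a≢b refl)
      occurs-pos-neg neg zer _   W = occurs-opp (occurs-∙ₛ W occurs-pos-pos)
      occurs-pos-neg neg pos _   W = occurs-opp W
      occurs-pos-neg zer neg _   W = occurs-∙ₛ W occurs-pos-pos
      occurs-pos-neg zer zer a≢b _ = ⊥-elim (a≢b refl)
      occurs-pos-neg zer pos _   W = occurs-∙ₛ (occurs-opp W) occurs-pos-pos
      occurs-pos-neg pos neg _   W = W
      occurs-pos-neg pos zer _   W = occurs-opp (occurs-∙ₛ (occurs-opp W) occurs-pos-pos)
      occurs-pos-neg pos pos a≢b _ = ⊥-elim (a≢b refl)

      occurs-∙ₛT⁺ : ∀ {e f a b} → a ≢ zer → b ≢ zer → Occurs e f a b →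
                    ∃ λ T → T ∈L L × Full T × lookup T e ≡ a × lookup T f ≡ b
      occurs-∙ₛT⁺ a≢0 b≢0 (W , W∈ , We , Wf) =
        compose W T⁺ , L2 W T⁺ W∈ (proj₁ acyclic) , compose-Full W T⁺ T⁺-Full ,
        trans (lookup-compose-≢zerˡ W T⁺ (subst (_≢ zer) (sym We) a≢0)) We ,
        trans (lookup-compose-≢zerˡ W T⁺ (subst (_≢ zer) (sym Wf) b≢0)) Wf

      non-parallel : NoParallel L → ∀ {e f} → e ≢ f → ∃ λ X → X ∈L L × lookup X e ≢ lookup X f
      non-parallel noParallel {e} {f} e≢f
        with ¬∀⇒∃¬ₛ (λ X → X ∈L? L →-dec lookup X e ≟ₛ lookup X f) (noParallel e f e≢f)
      ... | X , ¬[X∈⇒parallel] with X ∈L? L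
      ...   | yes X∈ = X , X∈ , λ parallel → ¬[X∈⇒parallel] λ _ → parallel
      ...   | no X∉  = ⊥-elim (¬[X∈⇒parallel] (⊥-elim ∘ X∉))

    NoParallel⇒RealisesSignPairs : NoParallel L → RealisesSignPairs L
    NoParallel⇒RealisesSignPairs noParallel {e} {f} e≢f {a} {b} a≢0 b≢0 =
      occurs-∙ₛT⁺ a≢0 b≢0 (occurs a b a≢0 b≢0)
      where
      occurs-pos-neg′ : Occurs e f pos neg
      occurs-pos-neg′ with non-parallel noParallel e≢f
      ... | X , X∈ , Xe≢Xf = occurs-pos-neg (lookup X e) (lookup X f) Xe≢Xf (X , X∈ , refl , refl)
      occurs : ∀ a b → a ≢ zer → b ≢ zer → Occurs e f a b
      occurs neg neg _ _ = occurs-opp occurs-pos-pos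
      occurs neg pos _ _ = occurs-opp occurs-pos-neg′
      occurs pos neg _ _ = occurs-pos-neg′
      occurs pos pos _ _ = occurs-pos-pos
      occurs zer _   a≢0 _ = ⊥-elim (a≢0 refl)
      occurs _   zer _ b≢0 = ⊥-elim (b≢0 refl)

    -- A nonzero covector X vanishing at e and g would lie on the chain 0 < X < X ∘ Z < X ∘ Z ∘ (+⋯+)
    -- of length 3, where Z vanishes at e but not at g.
    HasRank2⇒Rank≤2 : HasRank2 L → RealisesSignPairs L → Rank≤2 L
    HasRank2⇒Rank≤2 (_ , noLongerChain) realise X X∈ {e} {g} e≢g Xe≡0 Xg≡0 i with lookup X i ≟ₛ zer
    ... | yes Xi≡0 = Xi≡0
    ... | no Xi≢0 with ∃-covector-zer-pos realise e≢g
    ...   | Z , Z∈ , Ze≡0 , Zg≡pos = ⊥-elim (noLongerChain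
      ( X , XZ , compose XZ T⁺ , X∈ , XZ∈ , L2 XZ T⁺ XZ∈ (proj₁ acyclic)
      , ( (λ k → inj₁ (lookup-replicate k zer))
        , λ 0≡X → Xi≢0 (trans (cong (λ V → lookup V i) (sym 0≡X)) (lookup-replicate i zer)) )
      , Conf<-compose X Z g Xg≡0 (λ Zg≡0 → pos≢zer (trans (sym Zg≡pos) Zg≡0))
      , Conf<-compose XZ T⁺ e (trans (lookup-compose X Z e) (cong₂ _∙ₛ_ Xe≡0 Ze≡0)) (T⁺-Full e) ))
      where
      XZ : SignVec m
      XZ = compose X Z
      XZ∈ : XZ ∈L L
      XZ∈ = L2 X Z X∈ Z∈

-- Walls and peaks

module Rank2Structure {m} {N : SignSet m} (S : SimpleRank2 N) {p q : Fin m} (p≢q : p ≢ q) where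
  open SimpleRank2 S
  open IsOM isOM

  another : ∀ (i : Fin m) → ∃ λ o → i ≢ o
  another i with i ≟ᶠ p
  ... | yes refl = q , p≢q
  ... | no i≢p   = p , i≢p

  -- In a simple oriented matroid of rank 2 the topes are exactly the full covectors.
  Tope : SignVec m → Set
  Tope X = X ∈L N × Full X

  Tope? : ∀ X → Dec (Tope X)
  Tope? X = X ∈L? N ×-dec Fin.all? λ i → ¬? (lookup X i ≟ₛ zer)

  Tope⇒IsTope : ∀ {T} → Tope T → IsTope N T
  Tope⇒IsTope (T∈ , full) = T∈ , λ _ _ _ i _ → full i

  Tope-negate : ∀ {X} → Tope X → Tope (negate X)
  Tope-negate {X} (X∈ , full) = L1 X X∈ , negate-Full X full

  Tope-negate⁻ : ∀ {X} → Tope (negate X) → Tope X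
  Tope-negate⁻ {X} t = subst Tope (negate-involutive X) (Tope-negate t)

  IsCocircuitAt : Fin m → SignVec m → Set
  IsCocircuitAt e Y = Y ∈L N × lookup Y e ≡ zer × (∀ g → g ≢ e → lookup Y g ≢ zer)

  vanishes-once : ∀ {Z e k} → Z ∈L N → lookup Z e ≡ zer → lookup Z k ≢ zer →
                  ∀ g → g ≢ e → lookup Z g ≢ zer
  vanishes-once Z∈ Ze≡0 Zk≢0 g g≢e Zg≡0 = Zk≢0 (rank≤2 _ Z∈ (g≢e ∘ sym) Ze≡0 Zg≡0 _)

  cocircuit-negate : ∀ {e Y} → IsCocircuitAt e Y → IsCocircuitAt e (negate Y)
  cocircuit-negate {e} {Y} (Y∈ , Ye≡0 , Y≢0) =
    L1 Y Y∈ , trans (lookup-negate Y e) (cong opp Ye≡0) ,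
    λ g g≢e → opp-≢zer (Y≢0 g g≢e) ∘ trans (sym (lookup-negate Y g))

  cocircuit-exists : ∀ e → ∃ (IsCocircuitAt e)
  cocircuit-exists e with another e
  ... | f , e≢f with ∃-covector-zer-pos isOM realisesSignPairs e≢f
  ...   | Z , Z∈ , Ze≡0 , Zf≡pos = Z , Z∈ , Ze≡0 , vanishes-once Z∈ Ze≡0 (pos≢zer ∘ trans (sym Zf≡pos))

  -- Where Y and Y′ differ, eliminating would give a covector vanishing at e and there but not at f.
  cocircuit-≡ : ∀ {e f Y Y′} → IsCocircuitAt e Y → IsCocircuitAt e Y′ → f ≢ e →
                lookup Y′ f ≡ lookup Y f → Y′ ≡ Y
  cocircuit-≡ {e} {f} {Y} {Y′} (Y∈ , Ye≡0 , Y≢0) (Y′∈ , Y′e≡0 , Y′≢0) f≢e Y′f≡Yf =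
    lookup-ext agree
    where
    agree : ∀ g → lookup Y′ g ≡ lookup Y g
    agree g with g ≟ᶠ e
    ... | yes refl = trans Y′e≡0 (sym Ye≡0)
    ... | no g≢e with lookup Y′ g ≟ₛ lookup Y g
    ...   | yes Y′g≡Yg = Y′g≡Yg
    ...   | no Y′g≢Yg
      with L3 Y′ Y Y′∈ Y∈ g (≢⇒≡opp (Y′≢0 g g≢e) (Y≢0 g g≢e) Y′g≢Yg , Y′≢0 g g≢e)
    ... | Z , Z∈ , Zg≡0 , agrees = ⊥-elim (Y′≢0 f f≢e (trans (sym Zf≡Y′f) Zf≡0))
      where
      Ze≡0 : lookup Z e ≡ zer
      Ze≡0 = trans (agrees e (λ sep → proj₂ sep Y′e≡0)) (trans (lookup-compose-zerˡ Y′ Y Y′e≡0) Ye≡0)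
      Zf≡Y′f : lookup Z f ≡ lookup Y′ f
      Zf≡Y′f = trans (agrees f (≡⇒¬Separates Y′ Y Y′f≡Yf)) (lookup-compose-≢zerˡ Y′ Y (Y′≢0 f f≢e))
      Zf≡0 : lookup Z f ≡ zer
      Zf≡0 = rank≤2 Z Z∈ (g≢e ∘ sym) Ze≡0 Zg≡0 f

  cocircuit-unique : ∀ {e Y Y′} → IsCocircuitAt e Y → IsCocircuitAt e Y′ → Y′ ≡ Y ⊎ Y′ ≡ negate Y
  cocircuit-unique {e} {Y} {Y′} cY cY′ with another e
  ... | f , e≢f with lookup Y′ f ≟ₛ lookup Y f
  ...   | yes Y′f≡Yf = inj₁ (cocircuit-≡ cY cY′ (e≢f ∘ sym) Y′f≡Yf)
  ...   | no Y′f≢Yf  = inj₂ (cocircuit-≡ (cocircuit-negate cY) cY′ (e≢f ∘ sym)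
      (trans (≢⇒≡opp (proj₂ (proj₂ cY′) f (e≢f ∘ sym)) (proj₂ (proj₂ cY) f (e≢f ∘ sym)) Y′f≢Yf)
             (sym (lookup-negate Y f))))

  Wall : Fin m → SignVec m → Set
  Wall f X = (X [ f ]≔ zer) ∈L N

  Wall? : ∀ f X → Dec (Wall f X)
  Wall? f X = (X [ f ]≔ zer) ∈L? N

  wall-cocircuit : ∀ {f X} → Full X → Wall f X → IsCocircuitAt f (X [ f ]≔ zer)
  wall-cocircuit {f} {X} full wall =
    wall , lookup∘update f X zer , λ g g≢f → subst (_≢ zer) (sym (lookup∘update′ g≢f X zer)) (full g)

  private
    distance : SignVec m → SignVec m → ℕ
    distance T T′ = sum λ i → 𝟙[ ¬? (lookup T′ i ≟ₛ lookup T i) ]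

    -- Eliminating an element g separating T and T′ gives a covector Z that vanishes only at g. Either Z
    -- is T with g zeroed, so that g is a wall of T, or Z ∘ T is a tope between T and T′ other than T.
    wall-or-closer : ∀ {T T′ e} → Tope T → Tope T′ → T′ ≢ T → lookup T′ e ≡ lookup T e →
                     (∃ λ g → g ≢ e × Wall g T) ⊎
                     (∃ λ T″ → Tope T″ × T″ ≢ T × lookup T″ e ≡ lookup T e ×
                               distance T T″ < distance T T′)
    wall-or-closer {T} {T′} {e} (T∈ , T-full) (T′∈ , T′-full) T′≢T T′e≡Te
      with Fin.¬∀⟶∃¬ m _ (λ k → lookup T′ k ≟ₛ lookup T k) (T′≢T ∘ lookup-ext)
    ... | g , T′g≢Tg with L3 T T′ T∈ T′∈ g (≢⇒≡opp (T-full g) (T′-full g) (T′g≢Tg ∘ sym) , T-full g)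
    ... | Z , Z∈ , Zg≡0 , agrees = result
      where
      g≢e : g ≢ e
      g≢e refl = T′g≢Tg T′e≡Te
      Z-agrees : ∀ {k} → lookup T′ k ≡ lookup T k → lookup Z k ≡ lookup T k
      Z-agrees {k} eq = trans (agrees k (≡⇒¬Separates T T′ (sym eq))) (lookup-compose-≢zerˡ T T′ (T-full k))
      Z-off-g : ∀ k → k ≢ g → lookup Z k ≢ zer
      Z-off-g = vanishes-once Z∈ Zg≡0 (subst (_≢ zer) (sym (Z-agrees T′e≡Te)) (T-full e))
      T″ : SignVec m
      T″ = compose Z T
      T″-agrees : ∀ {k} → lookup T′ k ≡ lookup T k → lookup T″ k ≡ lookup T k
      T″-agrees {k} eq =
        trans (lookup-compose Z T k) (trans (cong (_∙ₛ lookup T k) (Z-agrees eq)) (∙ₛ-≢zerˡ _ (T-full k)))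
      T″g≡Tg : lookup T″ g ≡ lookup T g
      T″g≡Tg = lookup-compose-zerˡ Z T Zg≡0
      closer : distance T T″ < distance T T′
      closer = sum-mono-<
        (λ k → 𝟙-mono (¬? (lookup T″ k ≟ₛ lookup T k)) (¬? (lookup T′ k ≟ₛ lookup T k))
                      λ T″k≢Tk → T″k≢Tk ∘ T″-agrees)
        g (subst₂ _<_ (sym (𝟙-no (¬? (lookup T″ g ≟ₛ lookup T g)) (λ ne → ne T″g≡Tg)))
                      (sym (𝟙-yes (¬? (lookup T′ g ≟ₛ lookup T g)) T′g≢Tg)) (s≤s z≤n))
      result : (∃ λ g → g ≢ e × Wall g T) ⊎
               (∃ λ T″ → Tope T″ × T″ ≢ T × lookup T″ e ≡ lookup T e ×
                         distance T T″ < distance T T′)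
      result with T″ ≟ᵥ T
      ... | yes T″≡T =
        inj₁ (g , g≢e , subst (Wall g) T″≡T (subst (_∈L N) (sym ([]≔zer-compose Z T Zg≡0 Z-off-g)) Z∈))
      ... | no T″≢T  =
        inj₂ (T″ , (L2 Z T Z∈ T∈ , compose-Full Z T T-full) , T″≢T , T″-agrees T′e≡Te , closer)

  wall-exists : ∀ {T T′ e} → Tope T → Tope T′ → T′ ≢ T → lookup T′ e ≡ lookup T e →
                ∃ λ g → g ≢ e × Wall g T
  wall-exists {T} {T′} tT = search (<-wellFounded (distance T T′))
    where
    search : ∀ {T′ e} → Acc _<_ (distance T T′) → Tope T′ → T′ ≢ T → lookup T′ e ≡ lookup T e →
             ∃ λ g → g ≢ e × Wall g T
    search (acc rec) tT′ T′≢T agree with wall-or-closer tT tT′ T′≢T agree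
    ... | inj₁ wall = wall
    ... | inj₂ (_ , tT″ , T″≢T , agree″ , closer) = search (rec closer) tT″ T″≢T agree″

  wall-besides : ∀ {T} → Tope T → ∀ e → ∃ λ g → g ≢ e × Wall g T
  wall-besides tT@(_ , full) e with another e
  ... | o , e≢o with realisesSignPairs e≢o (full e) (opp-≢zer (full o))
  ...   | T′ , T′∈ , T′-full , T′e≡Te , T′o≡-To =
    wall-exists tT (T′∈ , T′-full) (λ { refl → opp-≢ (full o) (sym T′o≡-To) }) T′e≡Te

  cocircuit-across : ∀ {T g₁ g₂ f} → Tope T → Wall g₁ T → Wall g₂ T → g₂ ≢ g₁ → f ≢ g₁ → f ≢ g₂ →
                     ∃ λ Z → IsCocircuitAt f Z × lookup Z g₁ ≡ lookup T g₁ ×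
                             lookup Z g₂ ≡ opp (lookup T g₂)
  cocircuit-across {T} {g₁} {g₂} {f} (_ , full) w₁ w₂ g₂≢g₁ f≢g₁ f≢g₂ =
    across (L3 Y₂ Y₁⁻ w₂ (L1 Y₁ w₁) f separates)
    where
    open ≡-Reasoning
    Y₁ Y₂ Y₁⁻ : SignVec m
    Y₁  = T [ g₁ ]≔ zer
    Y₂  = T [ g₂ ]≔ zer
    Y₁⁻ = negate Y₁
    Y₁⁻g₁≡0 : lookup Y₁⁻ g₁ ≡ zer
    Y₁⁻g₁≡0 = trans (lookup-negate Y₁ g₁) (cong opp (lookup∘update g₁ T zer))
    Y₂g₁≡Tg₁ : lookup Y₂ g₁ ≡ lookup T g₁
    Y₂g₁≡Tg₁ = lookup∘update′ (g₂≢g₁ ∘ sym) T zer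
    Y₂g₂≡0 : lookup Y₂ g₂ ≡ zer
    Y₂g₂≡0 = lookup∘update g₂ T zer
    separates : Separates Y₂ Y₁⁻ f
    separates =
      trans (lookup∘update′ f≢g₂ T zer)
            (sym (trans (cong opp (trans (lookup-negate Y₁ f) (cong opp (lookup∘update′ f≢g₁ T zer))))
                        (opp-involutive _))) ,
      subst (_≢ zer) (sym (lookup∘update′ f≢g₂ T zer)) (full f)
    across : (Σ (SignVec m) λ Z → Z ∈L N × lookup Z f ≡ zer ×
               (∀ k → ¬ Separates Y₂ Y₁⁻ k → lookup Z k ≡ lookup (compose Y₂ Y₁⁻) k)) →
             ∃ λ Z → IsCocircuitAt f Z × lookup Z g₁ ≡ lookup T g₁ ×
                     lookup Z g₂ ≡ opp (lookup T g₂)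
    across (Z , Z∈ , Zf≡0 , agrees) =
      Z , (Z∈ , Zf≡0 , vanishes-once Z∈ Zf≡0 (subst (_≢ zer) (sym Zg₁≡Tg₁) (full g₁))) , Zg₁≡Tg₁ , Zg₂≡-Tg₂
      where
      Zg₁≡Tg₁ : lookup Z g₁ ≡ lookup T g₁
      Zg₁≡Tg₁ = trans (agrees g₁ λ (eq , Y₂g₁≢0) → Y₂g₁≢0 (trans eq (cong opp Y₁⁻g₁≡0)))
                      (trans (lookup-compose-≢zerˡ Y₂ Y₁⁻ (subst (_≢ zer) (sym Y₂g₁≡Tg₁) (full g₁))) Y₂g₁≡Tg₁)
      Zg₂≡-Tg₂ : lookup Z g₂ ≡ opp (lookup T g₂)
      Zg₂≡-Tg₂ = begin
        lookup Z g₂                 ≡⟨ agrees g₂ (λ (_ , Y₂g₂≢0) → Y₂g₂≢0 Y₂g₂≡0) ⟩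
        lookup (compose Y₂ Y₁⁻) g₂  ≡⟨ lookup-compose-zerˡ Y₂ Y₁⁻ Y₂g₂≡0 ⟩
        lookup Y₁⁻ g₂               ≡⟨ lookup-negate Y₁ g₂ ⟩
        opp (lookup Y₁ g₂)          ≡⟨ cong opp (lookup∘update′ g₂≢g₁ T zer) ⟩
        opp (lookup T g₂)           ∎

  -- The cocircuit at f is ±(T [ f ]≔ zer), which cannot agree with T at g₁ and disagree at g₂.
  no-third-wall : ∀ {T g₁ g₂ f} → Tope T → Wall g₁ T → Wall g₂ T → g₂ ≢ g₁ → f ≢ g₁ → f ≢ g₂ →
                  ¬ Wall f T
  no-third-wall {T} {g₁} {g₂} {f} tT@(_ , full) w₁ w₂ g₂≢g₁ f≢g₁ f≢g₂ w
    with cocircuit-across tT w₁ w₂ g₂≢g₁ f≢g₁ f≢g₂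
  ... | Z , cZ , Zg₁≡Tg₁ , Zg₂≡-Tg₂ with cocircuit-unique (wall-cocircuit full w) cZ
  ...   | inj₁ Z≡T[f]≔0 = opp-≢ (full g₂) (begin
    opp (lookup T g₂)           ≡⟨ Zg₂≡-Tg₂ ⟨
    lookup Z g₂                 ≡⟨ cong (λ V → lookup V g₂) Z≡T[f]≔0 ⟩
    lookup (T [ f ]≔ zer) g₂    ≡⟨ lookup∘update′ (f≢g₂ ∘ sym) T zer ⟩
    lookup T g₂                 ∎)
    where open ≡-Reasoning
  ...   | inj₂ Z≡-T[f]≔0 = full g₁ (opp-fixed⇒zer (begin
    lookup T g₁                        ≡⟨ Zg₁≡Tg₁ ⟨
    lookup Z g₁                        ≡⟨ cong (λ V → lookup V g₁) Z≡-T[f]≔0 ⟩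
    lookup (negate (T [ f ]≔ zer)) g₁  ≡⟨ lookup-negate (T [ f ]≔ zer) g₁ ⟩
    opp (lookup (T [ f ]≔ zer) g₁)     ≡⟨ cong opp (lookup∘update′ (f≢g₁ ∘ sym) T zer) ⟩
    opp (lookup T g₁)                  ∎))
    where open ≡-Reasoning

  wall-count : ∀ {T} → Tope T → sum (λ f → 𝟙[ Wall? f T ]) ≡ 2
  wall-count {T} tT with wall-besides tT p
  ... | g₁ , _ , w₁ with wall-besides tT g₁
  ...   | g₂ , g₂≢g₁ , w₂ = begin
    sum (λ f → 𝟙[ Wall? f T ])                             ≡⟨ sum-cong-≗ walls ⟩
    sum (λ f → 𝟙[ f ≟ᶠ g₁ ] + 𝟙[ f ≟ᶠ g₂ ])
      ≡⟨ ∑-distrib-+ (λ f → 𝟙[ f ≟ᶠ g₁ ]) (λ f → 𝟙[ f ≟ᶠ g₂ ]) ⟩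
    sum (λ f → 𝟙[ f ≟ᶠ g₁ ]) + sum (λ f → 𝟙[ f ≟ᶠ g₂ ])
      ≡⟨ cong₂ _+_ (sum-𝟙-≡ g₁) (sum-𝟙-≡ g₂) ⟩
    2                                                      ∎
    where
    open ≡-Reasoning
    walls : ∀ f → 𝟙[ Wall? f T ] ≡ 𝟙[ f ≟ᶠ g₁ ] + 𝟙[ f ≟ᶠ g₂ ]
    walls f with f ≟ᶠ g₁ | f ≟ᶠ g₂
    ... | yes refl | yes refl = ⊥-elim (g₂≢g₁ refl)
    ... | yes refl | no _     = 𝟙-yes (Wall? f T) w₁
    ... | no _     | yes refl = 𝟙-yes (Wall? f T) w₂
    ... | no f≢g₁  | no f≢g₂  = 𝟙-no (Wall? f T) (no-third-wall tT w₁ w₂ g₂≢g₁ f≢g₁ f≢g₂)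

  WallOfSign : Fin m → Sign → SignVec m → Set
  WallOfSign f s X = Wall f X × lookup X f ≡ s

  WallOfSign? : ∀ f s X → Dec (WallOfSign f s X)
  WallOfSign? f s X = Wall? f X ×-dec lookup X f ≟ₛ s

  #walls : Sign → SignVec m → ℕ
  #walls s X = sum λ f → 𝟙[ WallOfSign? f s X ]

  #walls-pos+neg : ∀ {X} → Tope X → #walls pos X + #walls neg X ≡ 2
  #walls-pos+neg {X} tX@(_ , full) =
    trans (sym (∑-distrib-+ (λ f → 𝟙[ WallOfSign? f pos X ]) (λ f → 𝟙[ WallOfSign? f neg X ])))
          (trans (sum-cong-≗ split) (wall-count tX))
    where
    split : ∀ f → 𝟙[ WallOfSign? f pos X ] + 𝟙[ WallOfSign? f neg X ] ≡ 𝟙[ Wall? f X ]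
    split f with Wall? f X | lookup X f | full f
    ... | no _  | _   | _   = refl
    ... | yes _ | neg | _   = refl
    ... | yes _ | pos | _   = refl
    ... | yes _ | zer | s≢0 = ⊥-elim (s≢0 refl)

  Wall-cross : ∀ {f X} → Wall f X → Wall f (X [ f ]%= opp)
  Wall-cross {f} {X} = subst (_∈L N) (sym ([]%=-[]≔ X f))

  Tope-cross : ∀ {f X} → Wall f X → Tope X → Tope (X [ f ]%= opp)
  Tope-cross {f} {X} wall (X∈ , full) =
    subst Tope (sym ([]%=opp≡compose X full))
      (L2 _ _ wall (L1 X X∈) , compose-Full (X [ f ]≔ zer) (negate X) (negate-Full X full))

  Wall∧Tope-cross⁻ : ∀ {f X} → Wall f (X [ f ]%= opp) → Tope (X [ f ]%= opp) → Wall f X × Tope X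
  Wall∧Tope-cross⁻ {f} {X} wall tope =
    subst (Wall f) (cross-cross) (Wall-cross wall) , subst Tope cross-cross (Tope-cross wall tope)
    where
    cross-cross : (X [ f ]%= opp) [ f ]%= opp ≡ X
    cross-cross = []%=opp-involutive X f

  Wall-negate : ∀ {f X} → Wall f X → Wall f (negate X)
  Wall-negate {f} {X} wall = subst (_∈L N) (sym (negate-[]≔zer X f)) (L1 _ wall)

  Wall-negate⁻ : ∀ {f X} → Wall f (negate X) → Wall f X
  Wall-negate⁻ {f} {X} wall = subst (Wall f) (negate-involutive X) (Wall-negate wall)

  #walls-negate : ∀ X → #walls neg (negate X) ≡ #walls pos X
  #walls-negate X = sum-cong-≗ λ f →
    𝟙-cong (WallOfSign? f neg (negate X)) (WallOfSign? f pos X)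
      (λ (wall , -Xf≡neg) → Wall-negate⁻ wall , opp≡neg⇒pos (trans (sym (lookup-negate X f)) -Xf≡neg))
      (λ (wall , Xf≡pos) → Wall-negate wall , trans (lookup-negate X f) (cong opp Xf≡pos))

  module PositiveSide (e : Fin m) where

    Positive : SignVec m → Set
    Positive X = Tope X × lookup X e ≡ pos

    Positive? : ∀ X → Dec (Positive X)
    Positive? X = Tope? X ×-dec lookup X e ≟ₛ pos

    #positive-with-wall : Fin m → Sign → ℕ
    #positive-with-wall f s = ∑ₛ λ X → 𝟙[ Positive? X ] * 𝟙[ WallOfSign? f s X ]

    -- The topes positive at e with wall e are Y ∘ P and (−Y) ∘ P, for Y the cocircuit at e and P any
    -- tope positive at e.
    #positive-with-wall-e-pos : #positive-with-wall e pos ≡ 2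
    #positive-with-wall-e-pos with cocircuit-exists e | another e
    ... | Y , cY@(_ , _ , Y≢0) | o , e≢o with realisesSignPairs e≢o {pos} {pos} (λ ()) (λ ())
    ...   | P , P∈ , P-full , Pe≡pos , _ =
      trans (∑ₛ-cong λ X → trans (sym (𝟙-× (Positive? X) (WallOfSign? e pos X)))
                               (𝟙-cong (Positive? X ×-dec (WallOfSign? e pos X)) (Positive? X ×-dec Wall? e X)
                                       (λ (pX , w , _) → pX , w) (λ (pX , w) → pX , w , proj₂ pX)))
            (∑ₛ-𝟙-pair (λ X → Positive? X ×-dec Wall? e X) Y∙P≢-Y∙P wall-e⇒±Y∙P
                       (cocircuit∙P cY) (cocircuit∙P (cocircuit-negate cY)))
      where
      cocircuit∙P : ∀ {Y′} → IsCocircuitAt e Y′ → Positive (compose Y′ P) × Wall e (compose Y′ P)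
      cocircuit∙P {Y′} (Y′∈ , Y′e≡0 , Y′≢0) =
        ((L2 Y′ P Y′∈ P∈ , compose-Full Y′ P P-full) , trans (lookup-compose-zerˡ Y′ P Y′e≡0) Pe≡pos) ,
        subst (_∈L N) (sym ([]≔zer-compose Y′ P Y′e≡0 Y′≢0)) Y′∈

      wall-e⇒±Y∙P : ∀ X → Positive X × Wall e X → X ≡ compose Y P ⊎ X ≡ compose (negate Y) P
      wall-e⇒±Y∙P X (((_ , full) , Xe≡pos) , wall) =
        Sum.map (λ X[e]≔0≡Y → trans X≡X[e]≔0∙P (cong (λ V → compose V P) X[e]≔0≡Y))
                (λ X[e]≔0≡-Y → trans X≡X[e]≔0∙P (cong (λ V → compose V P) X[e]≔0≡-Y))
                (cocircuit-unique cY (wall-cocircuit full wall))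
        where
        X≡X[e]≔0∙P : X ≡ compose (X [ e ]≔ zer) P
        X≡X[e]≔0∙P = ≡compose-[]≔zer X P full (trans Xe≡pos (sym Pe≡pos))

      Y∙P≢-Y∙P : compose Y P ≢ compose (negate Y) P
      Y∙P≢-Y∙P eq = opp-≢ Yo≢0 (begin
        opp (lookup Y o)                  ≡⟨ lookup-negate Y o ⟨
        lookup (negate Y) o               ≡⟨ lookup-compose-≢zerˡ (negate Y) P -Yo≢0 ⟨
        lookup (compose (negate Y) P) o   ≡⟨ cong (λ V → lookup V o) eq ⟨
        lookup (compose Y P) o            ≡⟨ lookup-compose-≢zerˡ Y P Yo≢0 ⟩
        lookup Y o                        ∎)
        where
        open ≡-Reasoning
        Yo≢0 : lookup Y o ≢ zer
        Yo≢0 = Y≢0 o (e≢o ∘ sym)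
        -Yo≢0 : lookup (negate Y) o ≢ zer
        -Yo≢0 = opp-≢zer Yo≢0 ∘ trans (sym (lookup-negate Y o))

    #positive-with-wall-e-neg : #positive-with-wall e neg ≡ 0
    #positive-with-wall-e-neg =
      trans (∑ₛ-cong λ X → trans (sym (𝟙-× (Positive? X) (WallOfSign? e neg X)))
                               (𝟙-no (Positive? X ×-dec (WallOfSign? e neg X))
                                     λ ((_ , Xe≡pos) , _ , Xe≡neg) → pos≢neg (trans (sym Xe≡pos) Xe≡neg)))
            (∑ₛ-zero m)

    #positive-with-wall-cross : ∀ {f} → f ≢ e → #positive-with-wall f pos ≡ #positive-with-wall f neg
    #positive-with-wall-cross {f} f≢e =
      trans (sym (∑ₛ-%=opp f λ X → 𝟙[ Positive? X ] * 𝟙[ WallOfSign? f pos X ])) (∑ₛ-cong crossing)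
      where
      crossing : ∀ X → 𝟙[ Positive? (X [ f ]%= opp) ] * 𝟙[ WallOfSign? f pos (X [ f ]%= opp) ]
                     ≡ 𝟙[ Positive? X ] * 𝟙[ WallOfSign? f neg X ]
      crossing X = begin
        𝟙[ Positive? X′ ] * 𝟙[ WallOfSign? f pos X′ ]
          ≡⟨ 𝟙-× (Positive? X′) (WallOfSign? f pos X′) ⟨
        𝟙[ Positive? X′ ×-dec (WallOfSign? f pos X′) ]
          ≡⟨ 𝟙-cong (Positive? X′ ×-dec (WallOfSign? f pos X′))
                    (Positive? X ×-dec (WallOfSign? f neg X)) uncross cross ⟩
        𝟙[ Positive? X ×-dec (WallOfSign? f neg X) ]
          ≡⟨ 𝟙-× (Positive? X) (WallOfSign? f neg X) ⟩
        𝟙[ Positive? X ] * 𝟙[ WallOfSign? f neg X ] ∎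
        where
        open ≡-Reasoning
        X′ : SignVec m
        X′ = X [ f ]%= opp
        X′e≡Xe : lookup X′ e ≡ lookup X e
        X′e≡Xe = lookup∘updateAt′ e f (f≢e ∘ sym) X
        X′f≡-Xf : lookup X′ f ≡ opp (lookup X f)
        X′f≡-Xf = lookup∘updateAt f X
        uncross : Positive X′ × WallOfSign f pos X′ → Positive X × WallOfSign f neg X
        uncross ((tope′ , X′e≡pos) , wall′ , X′f≡pos) with Wall∧Tope-cross⁻ wall′ tope′
        ... | wall , tope =
          (tope , trans (sym X′e≡Xe) X′e≡pos) , wall , opp≡pos⇒neg (trans (sym X′f≡-Xf) X′f≡pos)
        cross : Positive X × WallOfSign f neg X → Positive X′ × WallOfSign f pos X′
        cross ((tope , Xe≡pos) , wall , Xf≡neg) =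
          (Tope-cross wall tope , trans X′e≡Xe Xe≡pos) , Wall-cross wall , trans X′f≡-Xf (cong opp Xf≡neg)

    ∑ₛ-#walls : ∀ s → ∑ₛ (λ X → 𝟙[ Positive? X ] * #walls s X) ≡ sum (λ f → #positive-with-wall f s)
    ∑ₛ-#walls s =
      trans (∑ₛ-cong λ X → *-distribˡ-sum 𝟙[ Positive? X ] (λ f → 𝟙[ WallOfSign? f s X ]))
            (∑ₛ-sum-comm m λ X f → 𝟙[ Positive? X ] * 𝟙[ WallOfSign? f s X ])

    more-positive-walls : ∑ₛ (λ X → 𝟙[ Positive? X ] * #walls pos X) ≡
                          ∑ₛ (λ X → 𝟙[ Positive? X ] * #walls neg X) + 2
    more-positive-walls = begin
      ∑ₛ (λ X → 𝟙[ Positive? X ] * #walls pos X)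
        ≡⟨ ∑ₛ-#walls pos ⟩
      sum (λ f → #positive-with-wall f pos)
        ≡⟨ sum-cong-≗ crossing ⟩
      sum (λ f → #positive-with-wall f neg + 2 * 𝟙[ f ≟ᶠ e ])
        ≡⟨ ∑-distrib-+ (λ f → #positive-with-wall f neg) (λ f → 2 * 𝟙[ f ≟ᶠ e ]) ⟩
      sum (λ f → #positive-with-wall f neg) + sum (λ f → 2 * 𝟙[ f ≟ᶠ e ])
        ≡⟨ cong₂ _+_ (sym (∑ₛ-#walls neg))
                     (trans (sym (*-distribˡ-sum 2 (λ f → 𝟙[ f ≟ᶠ e ]))) (cong (2 *_) (sum-𝟙-≡ e))) ⟩
      ∑ₛ (λ X → 𝟙[ Positive? X ] * #walls neg X) + 2
        ∎
      where
      open ≡-Reasoning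
      crossing : ∀ f → #positive-with-wall f pos ≡ #positive-with-wall f neg + 2 * 𝟙[ f ≟ᶠ e ]
      crossing f with f ≟ᶠ e
      ... | yes refl = trans #positive-with-wall-e-pos (cong (_+ 2) (sym #positive-with-wall-e-neg))
      ... | no f≢e   = trans (#positive-with-wall-cross f≢e) (sym (+-identityʳ _))

    #peaks≡suc-#valleys : ∑ₛ (λ X → 𝟙[ Positive? X ×-dec #walls neg X ≟ 0 ])
                          ≡ suc (∑ₛ (λ X → 𝟙[ Positive? X ×-dec #walls pos X ≟ 0 ]))
    #peaks≡suc-#valleys = sym (*-cancelˡ-≡ (suc #valleys) #peaks 2 (+-cancelˡ-≡ #negWalls _ _ (begin
      #negWalls + 2 * suc #valleys
        ≡⟨ cong (#negWalls +_) (*-suc 2 #valleys) ⟩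
      #negWalls + (2 + 2 * #valleys)
        ≡⟨ +-assoc #negWalls 2 (2 * #valleys) ⟨
      #negWalls + 2 + 2 * #valleys
        ≡⟨ cong (_+ 2 * #valleys) more-positive-walls ⟨
      #posWalls + 2 * #valleys
        ≡⟨ cong (#posWalls +_) (∑ₛ-distribˡ-* 2 isValley) ⟨
      #posWalls + ∑ₛ (λ X → 2 * isValley X)
        ≡⟨ ∑ₛ-distrib-+ (λ X → 𝟙[ Positive? X ] * #walls pos X) (λ X → 2 * isValley X) ⟨
      ∑ₛ (λ X → 𝟙[ Positive? X ] * #walls pos X + 2 * isValley X)
        ≡⟨ ∑ₛ-cong (λ X → balance-on (Positive? X) (#walls pos X) (#walls neg X) (#walls-pos+neg ∘ proj₁)) ⟩
      ∑ₛ (λ X → 𝟙[ Positive? X ] * #walls neg X + 2 * isPeak X)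
        ≡⟨ ∑ₛ-distrib-+ (λ X → 𝟙[ Positive? X ] * #walls neg X) (λ X → 2 * isPeak X) ⟩
      #negWalls + ∑ₛ (λ X → 2 * isPeak X)
        ≡⟨ cong (#negWalls +_) (∑ₛ-distribˡ-* 2 isPeak) ⟩
      #negWalls + 2 * #peaks
        ∎)))
      where
      open ≡-Reasoning
      isPeak isValley : SignVec m → ℕ
      isPeak X = 𝟙[ Positive? X ×-dec #walls neg X ≟ 0 ]
      isValley X = 𝟙[ Positive? X ×-dec #walls pos X ≟ 0 ]
      #peaks #valleys #posWalls #negWalls : ℕ
      #peaks = ∑ₛ isPeak
      #valleys = ∑ₛ isValley
      #posWalls = ∑ₛ (λ X → 𝟙[ Positive? X ] * #walls pos X)
      #negWalls = ∑ₛ (λ X → 𝟙[ Positive? X ] * #walls neg X)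

  Peak : SignVec m → Set
  Peak X = Tope X × #walls neg X ≡ 0

  Peak? : ∀ X → Dec (Peak X)
  Peak? X = Tope? X ×-dec #walls neg X ≟ 0

  peaks : List (SignVec m)
  peaks = filter Peak? (allSignVecs m)

  ∈-peaks⁻ : ∀ {X} → X ∈ peaks → Peak X
  ∈-peaks⁻ = proj₂ ∘ ∈-filter⁻ Peak? {xs = allSignVecs m}

  ∈-peaks⁺ : ∀ {X} → Peak X → X ∈ peaks
  ∈-peaks⁺ {X} = ∈-filter⁺ Peak? (∈-allSignVecs X)

  peaks-Unique : Unique peaks
  peaks-Unique = Unique.filter⁺ Peak? (allSignVecs-Unique m)

  module _ (e : Fin m) where
    open PositiveSide e

    #peaks-at : Sign → ℕ
    #peaks-at s = ∑ₛ λ X → 𝟙[ X ∈ᵥ? peaks ] * 𝟙[ lookup X e ≟ₛ s ]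

    #peaks-at-pos : #peaks-at pos ≡ ∑ₛ (λ X → 𝟙[ Positive? X ×-dec #walls neg X ≟ 0 ])
    #peaks-at-pos = ∑ₛ-cong λ X → trans (sym (𝟙-× (X ∈ᵥ? peaks) (lookup X e ≟ₛ pos)))
      (𝟙-cong ((X ∈ᵥ? peaks) ×-dec (lookup X e ≟ₛ pos)) (Positive? X ×-dec #walls neg X ≟ 0)
        (λ (X∈ , Xe≡pos) → let (tope , no-neg) = ∈-peaks⁻ X∈ in (tope , Xe≡pos) , no-neg)
        (λ ((tope , Xe≡pos) , no-neg) → ∈-peaks⁺ (tope , no-neg) , Xe≡pos))

    #peaks-at-neg : #peaks-at neg ≡ ∑ₛ (λ X → 𝟙[ Positive? X ×-dec #walls pos X ≟ 0 ])
    #peaks-at-neg =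
      trans (sym (∑ₛ-negate λ X → 𝟙[ X ∈ᵥ? peaks ] * 𝟙[ lookup X e ≟ₛ neg ])) (∑ₛ-cong λ X →
        trans (sym (𝟙-× (negate X ∈ᵥ? peaks) (lookup (negate X) e ≟ₛ neg)))
              (𝟙-cong ((negate X ∈ᵥ? peaks) ×-dec (lookup (negate X) e ≟ₛ neg)) (Positive? X ×-dec #walls pos X ≟ 0)
                      (from X) (to X)))
      where
      from : ∀ X → negate X ∈ peaks × lookup (negate X) e ≡ neg → Positive X × #walls pos X ≡ 0
      from X (-X∈ , -Xe≡neg) with ∈-peaks⁻ -X∈
      ... | tope , no-neg = (Tope-negate⁻ tope , opp≡neg⇒pos (trans (sym (lookup-negate X e)) -Xe≡neg)) ,
                            trans (sym (#walls-negate X)) no-neg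
      to : ∀ X → Positive X × #walls pos X ≡ 0 → negate X ∈ peaks × lookup (negate X) e ≡ neg
      to X ((tope , Xe≡pos) , no-pos) =
        ∈-peaks⁺ (Tope-negate tope , trans (#walls-negate X) no-pos) , trans (lookup-negate X e) (cong opp Xe≡pos)

    length-peaks : length peaks ≡ #peaks-at pos + #peaks-at neg
    length-peaks = trans (length≡∑ₛ peaks-Unique) (trans (∑ₛ-cong split)
      (∑ₛ-distrib-+ (λ X → 𝟙[ X ∈ᵥ? peaks ] * 𝟙[ lookup X e ≟ₛ pos ])
                    (λ X → 𝟙[ X ∈ᵥ? peaks ] * 𝟙[ lookup X e ≟ₛ neg ])))
      where
      split : ∀ X → 𝟙[ X ∈ᵥ? peaks ] ≡
                    𝟙[ X ∈ᵥ? peaks ] * 𝟙[ lookup X e ≟ₛ pos ] + 𝟙[ X ∈ᵥ? peaks ] * 𝟙[ lookup X e ≟ₛ neg ]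
      split X with X ∈ᵥ? peaks
      ... | no _   = refl
      ... | yes X∈ with lookup X e | proj₂ (proj₁ (∈-peaks⁻ X∈)) e
      ...   | neg | _   = refl
      ...   | pos | _   = refl
      ...   | zer | s≢0 = ⊥-elim (s≢0 refl)

    #peaks-at-pos≡suc-neg : #peaks-at pos ≡ suc (#peaks-at neg)
    #peaks-at-pos≡suc-neg = trans #peaks-at-pos (trans #peaks≡suc-#valleys (cong suc (sym #peaks-at-neg)))

  peaks-committee : IsTopeCommittee N peaks
  peaks-committee = peaks-Unique , All.tabulate (Tope⇒IsTope ∘ proj₁ ∘ ∈-peaks⁻) , majority
    where
    majority : ∀ e → length peaks < 2 * countPos e peaks
    majority e = begin-strict
      length peaks                       ≡⟨ length-peaks e ⟩
      #peaks-at e pos + #peaks-at e neg  ≡⟨ cong (_+ #peaks-at e neg) (#peaks-at-pos≡suc-neg e) ⟩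
      suc n + n                          <⟨ +-monoʳ-< (suc n) (subst (n <_) (sym (+-identityʳ (suc n))) (n<1+n n)) ⟩
      2 * suc n                          ≡⟨ cong (2 *_) (#peaks-at-pos≡suc-neg e) ⟨
      2 * #peaks-at e pos                ≡⟨ cong (2 *_) (length-filter (λ K → lookup K e ≟ₛ pos) peaks-Unique) ⟨
      2 * countPos e peaks               ∎
      where
      open ≤-Reasoning
      n : ℕ
      n = #peaks-at e neg

mainTheorem2 : (m : ℕ) (L : SignSet m) → IsOM L → HasRank2 L → IsSimple L → IsAcyclic L →
               (js : List (Fin m)) → js ≢ [] →
               HasCriticalTopeCommittee (reorientSeq js L)
mainTheorem2 m L om rank2 (_ , noParallel , _) acyclic js _ with HasRank2⇒distinct rank2
... | _ , _ , p≢q =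
  TopeCommittee⇒HasCritical (Rank2Structure.peaks-committee (reorientSeq-SimpleRank2 js simpleRank2) p≢q)
  where
  signPairs : RealisesSignPairs L
  signPairs = NoParallel⇒RealisesSignPairs om acyclic noParallel
  simpleRank2 : SimpleRank2 L
  simpleRank2 = record
    { isOM              = om
    ; rank≤2            = HasRank2⇒Rank≤2 om acyclic rank2 signPairs
    ; realisesSignPairs = signPairs
    }
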